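{- Let $k,a,b,r$ be integers with $k\geq b>a\geq 1$ and $r\geq 1$. For $m\geq 1$, let $\mathcal{BP}_{a,b,k,r}(m)$ be the set of partitions $\pi=(\pi_1,\ldots,\pi_m)$ with exactly $m$ parts such that (1) each $\pi_i$ is congruent to $a$ or $b$ modulo $k$; (2) $\pi_m=a$ or $\pi_m=b$; (3) $\pi_i-\pi_{i+1}<k$ for $1\leq i<m$; (4) for $1\leq i\leq m-r$, if $\pi_{i+1}=\pi_{i+2}=\cdots=\pi_{i+r}\equiv b\pmod k$ then $\pi_i\equiv a\pmod k$. Then for $m\geq 1$, \begin{align*} &\sum_{\pi\in\mathcal{BP}_{a,b,k,r}(m)}\mu^{\ell_{k,a}(\pi)}\nu^{\ell_{k,b}(\pi)}q^{|\pi|}\\ &=\mu^mq^{ma}+\sum_{s\geq 1}\sum_{h\geq 0}\mu^{m-h-s}\nu^{h+s}q^{(m-h-s)a+(h+s)b+k(s^2-s)}g_{k,r}(h,s){{m-h-s+1}\brack {s}}_{k}, \end{align*} where $g_{k,r}(h,s)=\sum_{i\geq 0}(-1)^iq^{rk(i^2-i)/2}{{s}\brack {i}}_{rk}{{h-ri+s-1}\brack {s-1}}_{k}$.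
   Context: Partitions are non-increasing finite sequences of positive integers; $|\pi|$ is the sum of parts; $\ell_{k,d}(\pi)$ is the number of parts congruent to $d$ modulo $k$. $(x;q)_0=1$, $(x;q)_n=(1-x)\cdots(1-xq^{n-1})$. For a positive integer $k$ and integers $A,B$, ${A\brack B}_k=\frac{(q^k;q^k)_A}{(q^k;q^k)_B(q^k;q^k)_{A-B}}$ if $A\geq B\geq 0$, and $0$ otherwise. -}

module Defs where

open import Level using (Level)
open import Data.Nat using (ℕ; zero; suc; _∸_; _≤_; _<_; NonZero) renaming (_+_ to _+ℕ_; _*_ to _*ℕ_)
open import Data.Nat.DivMod using (_%_)
open import Data.Nat.ListAction using (sum)
import Data.Nat as ℕ
open import Data.Integer as ℤ using (ℤ; +_; -[1+_])
open import Data.List using (List; []; _∷_; length; filter)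
import Data.List as L
open import Data.Sum using (_⊎_)
open import Data.Product using (_×_)
open import Relation.Binary.PropositionalEquality using (_≡_)
open import Algebra.Bundles using (CommutativeRing)

-- i-th entry (0-based) of a list; default 0 outside range (never used in
-- the conditions below, which only refer to valid indices).
at : List ℕ → ℕ → ℕ
at []       _       = 0
at (x ∷ xs) zero    = x
at (x ∷ xs) (suc i) = at xs i

ℓ : (k : ℕ) → .{{NonZero k}} → ℕ → List ℕ → ℕ
ℓ k d π = length (filter (λ x → x % k ℕ.≟ d % k) π)

size : List ℕ → ℕ
size = sum

-- π ∈ BP_{a,b,k,r}(m), with π = (π_1,...,π_m) stored as the list
-- [π_1, ..., π_m] and indexed 0-based (at π j = π_{j+1}).
record BP (a b k r m : ℕ) .{{_ : NonZero k}} (π : List ℕ) : Set where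
  field
    len       : length π ≡ m
    positive  : ∀ j → j < m → 1 ≤ at π j
    nonincr   : ∀ j → suc j < m → at π (suc j) ≤ at π j
    residues  : ∀ j → j < m → (at π j % k ≡ a % k) ⊎ (at π j % k ≡ b % k)
    lastPart  : (at π (m ∸ 1) ≡ a) ⊎ (at π (m ∸ 1) ≡ b)
    gaps      : ∀ j → suc j < m → at π j ∸ at π (suc j) < k
    -- (4)  (1-based i = j+1, 1 ≤ i ≤ m-r  ⇔  j + r < m)
    runs      : ∀ j → j +ℕ r < m →
                (∀ t → t < r → at π (suc j +ℕ t) ≡ at π (suc j)) →
                at π (suc j) % k ≡ b % k →
                at π j % k ≡ a % k

module _ {c ℓ′ : Level} (R : CommutativeRing c ℓ′) where
  open CommutativeRing R

  pow : Carrier → ℕ → Carrier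
  pow x zero    = 1#
  pow x (suc n) = x * pow x n

  sumR : ℕ → (ℕ → Carrier) → Carrier
  sumR zero    f = 0#
  sumR (suc n) f = sumR n f + f n

  sumList : List Carrier → Carrier
  sumList = L.foldr _+_ 0#

  gaussN : Carrier → ℕ → ℕ → Carrier
  gaussN Q n       zero    = 1#
  gaussN Q zero    (suc j) = 0#
  gaussN Q (suc n) (suc j) = gaussN Q n j + pow Q (suc j) * gaussN Q n (suc j)

  -- [A brack B]_k (in the variable q), integer arguments; 0 if A<0 or B<0
  -- (and 0 if B > A, automatically from the recursion).
  qbin : (q : Carrier) (k : ℕ) → ℤ → ℤ → Carrier
  qbin q k (+ A) (+ B) = gaussN (pow q k) A B
  qbin q k _     _     = 0#

  -- g_{k,r}(h,s); the sum over i ≥ 0 is truncated at i ≤ s since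
  -- [s brack i]_{rk} = 0 for i > s.
  g : (q : Carrier) (k r h s : ℕ) → Carrier
  g q k r h s = sumR (suc s) λ i →
      pow (- 1#) i
    * pow q ((r *ℕ k *ℕ (i *ℕ i ∸ i)) ℕ./ 2)
    * qbin q (r *ℕ k) (+ s) (+ i)
    * qbin q k (+ h ℤ.- + (r *ℕ i) ℤ.+ + s ℤ.- + 1) (+ (s ∸ 1))

  weight : (μ ν q : Carrier) (a b k : ℕ) .{{_ : NonZero k}} → List ℕ → Carrier
  weight μ ν q a b k π = pow μ (ℓ k a π) * pow ν (ℓ k b π) * pow q (size π)

  -- Sums over s ≥ 1, h ≥ 0 are truncated at s ≤ m, h ≤ m:
  -- every omitted term has m-h-s+1 < s, so its Gaussian factor is 0.
  -- Likewise, in every nonzero term m-h-s ≥ 0, so ∸ is exact there.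
  rhs : (μ ν q : Carrier) (a b k r m : ℕ) → Carrier
  rhs μ ν q a b k r m =
    pow μ m * pow q (m *ℕ a) +
    sumR m λ s′ → let s = suc s′ in sumR (suc m) λ h →
        pow μ (m ∸ h ∸ s) * pow ν (h +ℕ s)
      * pow q ((m ∸ h ∸ s) *ℕ a +ℕ (h +ℕ s) *ℕ b +ℕ k *ℕ (s *ℕ s ∸ s))
      * g q k r h s
      * qbin q k (+ m ℤ.- + h ℤ.- + s ℤ.+ + 1) (+ s)

{-# OPTIONS --safe #-}
module Submission where

-- The parts of a partition in BP(m) have residues a or b and consecutive differences below k,
-- so read from the bottom they climb the ladder a < b < a + k < b + k < a + 2k < ⋯ rung by
-- rung (only the bottom rung a may be missing), and condition (4) says exactly that every rung
-- b + jk is used at most r times.  Such a partition is therefore determined by its height s,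
-- the number of b-rungs, and by the multiplicities of the rungs.  The weight factorises over
-- the rungs: summing over the a-multiplicities is a q-hockey-stick sum giving
-- [m - h - s + 1 brack s]_k, and summing over the b-multiplicities 1 + βᵢ with βᵢ < r and
-- ∑ β = h gives, by inclusion–exclusion over the βᵢ that reach r, the factor g_{k,r}(h, s).

open import Level using (Level)
open import Algebra.Bundles using (CommutativeRing; Semiring)
open import Data.Nat using (ℕ; zero; suc; _≤_; _<_; NonZero)
open import Data.List using (List)
open import Data.List.Membership.Propositional using (_∈_)
open import Data.List.Membership.Propositional.Properties.WithK using (unique∧set⇒bag)
open import Data.List.Relation.Binary.BagAndSetEquality using (∼bag⇒↭)
open import Data.List.Relation.Binary.Permutation.Propositional using (_↭_)
open import Data.List.Relation.Unary.Unique.Propositional using (Unique)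
open import Function.Bundles using (_⇔_)
open import Function.Construct.Composition using (_⇔-∘_)
open import Function.Construct.Symmetry using (⇔-sym)
import Relation.Binary.Reasoning.Setoid as ≈-Reasoning
open import Defs

module Enumeration where

  open import Data.Nat using (_+_; _∸_; z≤n; s≤s; _≟_)
  open import Data.Nat.Properties using (≤-refl; ≤-pred; m<n⇒m<1+n; ≤∧≢⇒<; <-irrefl)
  open import Data.List using ([]; _∷_; _++_; map)
  open import Data.List.Membership.Propositional.Properties using (∈-++⁻; ∈-++⁺ˡ; ∈-++⁺ʳ)
  open import Data.List.Relation.Unary.AllPairs using ([]; _∷_)
  open import Data.List.Relation.Unary.All using (All; []; _∷_)
  open import Data.List.Relation.Unary.Any using (here; there)
  import Data.List.Relation.Unary.Unique.Propositional.Properties as Unique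
  open import Data.Product using (_×_; _,_; ∃)
  open import Data.Sum using (inj₁; inj₂)
  open import Relation.Nullary using (yes; no)
  open import Relation.Binary.PropositionalEquality using (_≡_; _≢_; refl; subst; sym)

  concatRange : ∀ {A : Set} → ℕ → (ℕ → List A) → List A
  concatRange zero    f = []
  concatRange (suc n) f = concatRange n f ++ f n

  module _ {A : Set} (f : ℕ → List A) where

    ∈-concatRange⁻ : ∀ n {z} → z ∈ concatRange n f → ∃ λ i → i < n × z ∈ f i
    ∈-concatRange⁻ (suc n) z∈ with ∈-++⁻ (concatRange n f) z∈
    ... | inj₁ z∈init = let (i , i<n , z∈fi) = ∈-concatRange⁻ n z∈init in i , m<n⇒m<1+n i<n , z∈fi
    ... | inj₂ z∈last = n , ≤-refl , z∈last

    ∈-concatRange⁺ : ∀ n {z} i → i < n → z ∈ f i → z ∈ concatRange n f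
    ∈-concatRange⁺ (suc n) i i<1+n z∈ with i ≟ n
    ... | yes refl = ∈-++⁺ʳ (concatRange n f) z∈
    ... | no i≢n   = ∈-++⁺ˡ (∈-concatRange⁺ n i (≤∧≢⇒< (≤-pred i<1+n) i≢n) z∈)

    concatRange-unique : ∀ n → (∀ i → i < n → Unique (f i)) →
                         (∀ i j {z} → i < n → j < n → z ∈ f i → z ∈ f j → i ≡ j) →
                         Unique (concatRange n f)
    concatRange-unique zero    _      _        = []
    concatRange-unique (suc n) unique disjoint =
      Unique.++⁺ (concatRange-unique n (λ i i<n → unique i (m<n⇒m<1+n i<n))
                   (λ i j i<n j<n → disjoint i j (m<n⇒m<1+n i<n) (m<n⇒m<1+n j<n)))
                 (unique n ≤-refl)
                 (λ (z∈init , z∈last) →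
                   let (i , i<n , z∈fi) = ∈-concatRange⁻ n z∈init
                   in <-irrefl (disjoint i n (m<n⇒m<1+n i<n) ≤-refl z∈fi z∈last) i<n)

  -- f, extended by d to negative arguments, at h - x
  atDiff : ∀ {ℓ} {A : Set ℓ} → A → (ℕ → A) → ℕ → ℕ → A
  atDiff d f h       zero    = f h
  atDiff d f zero    (suc x) = d
  atDiff d f (suc h) (suc x) = atDiff d f h x

  module _ {ℓ : Level} {A : Set ℓ} (d : A) (f : ℕ → A) where

    atDiff-≤ : ∀ {h x} → x ≤ h → atDiff d f h x ≡ f (h ∸ x)
    atDiff-≤ {h}     {zero}  _         = refl
    atDiff-≤ {suc h} {suc x} (s≤s x≤h) = atDiff-≤ x≤h

    atDiff-> : ∀ {h x} → h < x → atDiff d f h x ≡ d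
    atDiff-> {zero}  {suc x} _         = refl
    atDiff-> {suc h} {suc x} (s≤s h<x) = atDiff-> h<x

    atDiff-atDiff : ∀ h x t → atDiff d (λ n → atDiff d f n t) h x ≡ atDiff d f h (x + t)
    atDiff-atDiff h       zero    t = refl
    atDiff-atDiff zero    (suc x) t = refl
    atDiff-atDiff (suc h) (suc x) t = atDiff-atDiff h x t

  atDiff-pointwise : ∀ {ℓ ℓ′ ℓ″} {A : Set ℓ} {B : Set ℓ′} (_∼_ : A → B → Set ℓ″) {d d′ f g} →
                     d ∼ d′ → (∀ n → f n ∼ g n) → ∀ h x → atDiff d f h x ∼ atDiff d′ g h x
  atDiff-pointwise _∼_ d∼d′ f∼g h       zero    = f∼g h
  atDiff-pointwise _∼_ d∼d′ f∼g zero    (suc x) = d∼d′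
  atDiff-pointwise _∼_ d∼d′ f∼g (suc h) (suc x) = atDiff-pointwise _∼_ d∼d′ f∼g h x

  module _ {A : Set} (f : ℕ → List A) where

    ∈-atDiff⁻ : ∀ h x {z} → z ∈ atDiff [] f h x → x ≤ h × z ∈ f (h ∸ x)
    ∈-atDiff⁻ h       zero    z∈ = z≤n , z∈
    ∈-atDiff⁻ (suc h) (suc x) z∈ = let (x≤h , z∈f) = ∈-atDiff⁻ h x z∈ in s≤s x≤h , z∈f

    ∈-atDiff⁺ : ∀ {h x z} → x ≤ h → z ∈ f (h ∸ x) → z ∈ atDiff [] f h x
    ∈-atDiff⁺ x≤h z∈ = subst (_ ∈_) (sym (atDiff-≤ [] f x≤h)) z∈

    atDiff-unique : (∀ n → Unique (f n)) → ∀ h x → Unique (atDiff [] f h x)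
    atDiff-unique unique h       zero    = unique h
    atDiff-unique unique zero    (suc x) = []
    atDiff-unique unique (suc h) (suc x) = atDiff-unique unique h x

  map-unique-on : ∀ {A B : Set} (f : A → B) {xs} →
                  (∀ {x y} → x ∈ xs → y ∈ xs → f x ≡ f y → x ≡ y) → Unique xs → Unique (map f xs)
  map-unique-on f {[]}     _   []           = []
  map-unique-on f {x ∷ xs} inj (x∉xs ∷ uxs) =
    map-distinct xs x∉xs (λ y∈ → inj (here refl) (there y∈)) ∷
    map-unique-on f (λ x∈ y∈ → inj (there x∈) (there y∈)) uxs
    where
    map-distinct : ∀ ys → All (x ≢_) ys → (∀ {y} → y ∈ ys → f x ≡ f y → x ≡ y) → All (f x ≢_) (map f ys)
    map-distinct []       []             _   = []
    map-distinct (y ∷ ys) (x≢y ∷ x≢ys) inj′ =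
      (λ fx≡fy → x≢y (inj′ (here refl) fx≡fy)) ∷ map-distinct ys x≢ys (λ y∈ → inj′ (there y∈))

module RingSums {c ℓ′} (R : CommutativeRing c ℓ′) where

  open import Data.Nat using () renaming (_+_ to _+ℕ_; _*_ to _*ℕ_)
  open import Data.Nat.Properties using (≤-refl; m<n⇒m<1+n)
  open import Data.List using ([]; _∷_; _++_; map; cartesianProduct)
  import Data.List.Properties as List
  open import Data.List.Relation.Unary.Any using (here; there)
  open import Data.List.Relation.Binary.Permutation.Propositional using (↭⇒↭ₛ′)
  import Data.List.Relation.Binary.Permutation.Propositional.Properties as ↭
  import Data.List.Relation.Binary.Permutation.Setoid.Properties as ↭ₛ
  open import Data.Product using (_,_; proj₁; proj₂)
  open import Relation.Binary.PropositionalEquality as ≡ using (_≡_)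
  import Algebra.Definitions.RawSemiring as RawSemiring
  open Enumeration using (concatRange; atDiff; atDiff-atDiff; atDiff-pointwise)

  open CommutativeRing R
  import Algebra.Properties.Semiring.Exp semiring as Exp
  import Algebra.Properties.CommutativeSemiring.Exp commutativeSemiring as CommExp
  open RawSemiring (Semiring.rawSemiring semiring) using () renaming (_^_ to _^ₛ_)
  open import Algebra.Solver.Ring.NaturalCoefficients.Default commutativeSemiring using (solve; _:=_; _:+_)
  open import Relation.Binary.Reasoning.Setoid setoid

  infixr 8 _^_
  _^_ : Carrier → ℕ → Carrier
  x ^ n = pow R x n

  -- pow unfolds exactly like the library's _^_, whose laws therefore transfer
  private
    ^≡^ₛ : ∀ x n → x ^ n ≡ x ^ₛ n
    ^≡^ₛ x zero    = ≡.refl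
    ^≡^ₛ x (suc n) = ≡.cong (x *_) (^≡^ₛ x n)

  ^-congˡ : ∀ {x y} n → x ≈ y → x ^ n ≈ y ^ n
  ^-congˡ {x} {y} n x≈y rewrite ^≡^ₛ x n | ^≡^ₛ y n = Exp.^-congˡ n x≈y

  ^-congʳ : ∀ x {m n} → m ≡ n → x ^ m ≈ x ^ n
  ^-congʳ x ≡.refl = refl

  ^-homo-* : ∀ x m n → x ^ (m +ℕ n) ≈ x ^ m * x ^ n
  ^-homo-* x m n rewrite ^≡^ₛ x (m +ℕ n) | ^≡^ₛ x m | ^≡^ₛ x n = Exp.^-homo-* x m n

  ^-assocʳ : ∀ x m n → (x ^ m) ^ n ≈ x ^ (m *ℕ n)
  ^-assocʳ x m n rewrite ^≡^ₛ (x ^ m) n | ^≡^ₛ x m | ^≡^ₛ x (m *ℕ n) = Exp.^-assocʳ x m n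

  ^-distrib-* : ∀ x y n → (x * y) ^ n ≈ x ^ n * y ^ n
  ^-distrib-* x y n rewrite ^≡^ₛ (x * y) n | ^≡^ₛ x n | ^≡^ₛ y n = CommExp.^-distrib-* x y n

  ∑< : ℕ → (ℕ → Carrier) → Carrier
  ∑< = sumR R

  syntax ∑< n (λ i → e) = ∑[ i < n ] e

  ∑-cong-< : ∀ n {f g} → (∀ i → i < n → f i ≈ g i) → ∑< n f ≈ ∑< n g
  ∑-cong-< zero    f≈g = refl
  ∑-cong-< (suc n) f≈g = +-cong (∑-cong-< n (λ i i<n → f≈g i (m<n⇒m<1+n i<n))) (f≈g n ≤-refl)

  ∑-cong : ∀ n {f g} → (∀ i → f i ≈ g i) → ∑< n f ≈ ∑< n g
  ∑-cong n f≈g = ∑-cong-< n (λ i _ → f≈g i)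

  ∑-zero : ∀ n {f} → (∀ i → i < n → f i ≈ 0#) → ∑< n f ≈ 0#
  ∑-zero n f≈0 = trans (∑-cong-< n f≈0) (zero-sum n)
    where
    zero-sum : ∀ n → ∑[ i < n ] 0# ≈ 0#
    zero-sum zero    = refl
    zero-sum (suc n) = trans (+-identityʳ _) (zero-sum n)

  ∑-distrib-+ : ∀ n f g → ∑[ i < n ] (f i + g i) ≈ ∑< n f + ∑< n g
  ∑-distrib-+ zero    f g = sym (+-identityʳ 0#)
  ∑-distrib-+ (suc n) f g = begin
    ∑[ i < n ] (f i + g i) + (f n + g n) ≈⟨ +-congʳ (∑-distrib-+ n f g) ⟩
    ∑< n f + ∑< n g + (f n + g n)        ≈⟨ solve 4 (λ a b c d → (a :+ b) :+ (c :+ d) := (a :+ c) :+ (b :+ d)) refl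
                                                  (∑< n f) (∑< n g) (f n) (g n) ⟩
    ∑< n f + f n + (∑< n g + g n)        ∎

  ∑-distribˡ-* : ∀ n x f → x * ∑< n f ≈ ∑[ i < n ] (x * f i)
  ∑-distribˡ-* zero    x f = zeroʳ x
  ∑-distribˡ-* (suc n) x f = trans (distribˡ x _ _) (+-congʳ (∑-distribˡ-* n x f))

  ∑-first : ∀ n f → ∑< (suc n) f ≈ f 0 + ∑[ i < n ] f (suc i)
  ∑-first zero    f = trans (+-identityˡ _) (sym (+-identityʳ _))
  ∑-first (suc n) f = trans (+-congʳ (∑-first n f)) (+-assoc _ _ _)

  ∑-comm : ∀ n m (f : ℕ → ℕ → Carrier) → ∑[ i < n ] ∑[ j < m ] f i j ≈ ∑[ j < m ] ∑[ i < n ] f i j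
  ∑-comm zero    m f = sym (∑-zero m (λ _ _ → refl))
  ∑-comm (suc n) m f = begin
    ∑[ i < n ] ∑[ j < m ] f i j + ∑[ j < m ] f n j ≈⟨ +-congʳ (∑-comm n m f) ⟩
    ∑[ j < m ] ∑[ i < n ] f i j + ∑[ j < m ] f n j ≈⟨ ∑-distrib-+ m _ _ ⟨
    ∑[ j < m ] (∑[ i < n ] f i j + f n j)          ∎

  private variable A B : Set

  ∑L : (A → Carrier) → List A → Carrier
  ∑L f xs = sumList R (map f xs)

  ∑L-++ : ∀ (f : A → Carrier) xs ys → ∑L f (xs ++ ys) ≈ ∑L f xs + ∑L f ys
  ∑L-++ f []       ys = sym (+-identityˡ _)
  ∑L-++ f (x ∷ xs) ys = trans (+-congˡ (∑L-++ f xs ys)) (sym (+-assoc _ _ _))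

  ∑L-cong : ∀ {f g : A → Carrier} xs → (∀ {x} → x ∈ xs → f x ≈ g x) → ∑L f xs ≈ ∑L g xs
  ∑L-cong []       f≈g = refl
  ∑L-cong (x ∷ xs) f≈g = +-cong (f≈g (here ≡.refl)) (∑L-cong xs (λ x∈ → f≈g (there x∈)))

  ∑L-map : ∀ (f : B → Carrier) (g : A → B) xs → ∑L f (map g xs) ≈ ∑L (λ x → f (g x)) xs
  ∑L-map f g xs = reflexive (≡.cong (sumList R) (≡.sym (List.map-∘ xs)))

  ∑L-distribˡ-* : ∀ x (f : A → Carrier) xs → x * ∑L f xs ≈ ∑L (λ y → x * f y) xs
  ∑L-distribˡ-* x f []       = zeroʳ x
  ∑L-distribˡ-* x f (y ∷ ys) = trans (distribˡ x _ _) (+-congˡ (∑L-distribˡ-* x f ys))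

  ∑L-cartesianProduct : ∀ (f : A → Carrier) (g : B → Carrier) xs ys →
    ∑L (λ p → f (proj₁ p) * g (proj₂ p)) (cartesianProduct xs ys) ≈ ∑L f xs * ∑L g ys
  ∑L-cartesianProduct f g []       ys = sym (zeroˡ _)
  ∑L-cartesianProduct f g (x ∷ xs) ys = begin
    ∑L fg (map (x ,_) ys ++ cartesianProduct xs ys)     ≈⟨ ∑L-++ fg (map (x ,_) ys) _ ⟩
    ∑L fg (map (x ,_) ys) + ∑L fg (cartesianProduct xs ys)
      ≈⟨ +-cong (∑L-map fg (x ,_) ys) (∑L-cartesianProduct f g xs ys) ⟩
    ∑L (λ y → f x * g y) ys + ∑L f xs * ∑L g ys        ≈⟨ +-congʳ (∑L-distribˡ-* (f x) g ys) ⟨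
    f x * ∑L g ys + ∑L f xs * ∑L g ys                  ≈⟨ distribʳ _ _ _ ⟨
    (f x + ∑L f xs) * ∑L g ys                          ∎
    where fg = λ p → f (proj₁ p) * g (proj₂ p)

  ∑L-concatRange : ∀ (f : A → Carrier) n g → ∑L f (concatRange n g) ≈ ∑[ i < n ] ∑L f (g i)
  ∑L-concatRange f zero    g = refl
  ∑L-concatRange f (suc n) g = trans (∑L-++ f (concatRange n g) (g n)) (+-congʳ (∑L-concatRange f n g))

  ∑L-↭ : ∀ (f : A → Carrier) {xs ys} → xs ↭ ys → ∑L f xs ≈ ∑L f ys
  ∑L-↭ f xs↭ys = ↭ₛ.foldr-commMonoid setoid +-isCommutativeMonoid (↭⇒↭ₛ′ isEquivalence (↭.map⁺ f xs↭ys))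

  ∑L-atDiff : ∀ (f : A → Carrier) g h x → ∑L f (atDiff [] g h x) ≈ atDiff 0# (λ n → ∑L f (g n)) h x
  ∑L-atDiff f g = atDiff-pointwise (λ xs y → ∑L f xs ≈ y) refl (λ _ → refl)

  atDiff-cong : ∀ {f g : ℕ → Carrier} → (∀ n → f n ≈ g n) → ∀ h x → atDiff 0# f h x ≈ atDiff 0# g h x
  atDiff-cong = atDiff-pointwise _≈_ refl

  atDiff-distribˡ-* : ∀ y f h x → y * atDiff 0# f h x ≈ atDiff 0# (λ n → y * f n) h x
  atDiff-distribˡ-* y f = atDiff-pointwise (λ u v → y * u ≈ v) (zeroʳ y) (λ _ → refl)

  atDiff-∑ : ∀ m (f : ℕ → ℕ → Carrier) h x → atDiff 0# (λ n → ∑[ i < m ] f i n) h x ≈ ∑[ i < m ] atDiff 0# (f i) h x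
  atDiff-∑ m f h       zero    = refl
  atDiff-∑ m f zero    (suc x) = sym (∑-zero m (λ _ _ → refl))
  atDiff-∑ m f (suc h) (suc x) = atDiff-∑ m f h x

  atDiff-expansion : ∀ m (coeff : ℕ → Carrier) (f : ℕ → Carrier) (t : ℕ → ℕ) {F : ℕ → Carrier} →
                     (∀ n → F n ≈ ∑[ i < m ] (coeff i * atDiff 0# f n (t i))) →
                     ∀ h x → atDiff 0# F h x ≈ ∑[ i < m ] (coeff i * atDiff 0# f h (x +ℕ t i))
  atDiff-expansion m coeff f t F≈ h x = begin
    atDiff 0# _ h x
      ≈⟨ atDiff-cong F≈ h x ⟩
    atDiff 0# (λ n → ∑[ i < m ] (coeff i * atDiff 0# f n (t i))) h x
      ≈⟨ atDiff-∑ m (λ i n → coeff i * atDiff 0# f n (t i)) h x ⟩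
    ∑[ i < m ] atDiff 0# (λ n → coeff i * atDiff 0# f n (t i)) h x
      ≈⟨ ∑-cong m (λ i → atDiff-distribˡ-* (coeff i) _ h x) ⟨
    ∑[ i < m ] (coeff i * atDiff 0# (λ n → atDiff 0# f n (t i)) h x)
      ≈⟨ ∑-cong m (λ i → *-congˡ (reflexive (atDiff-atDiff 0# f h x (t i)))) ⟩
    ∑[ i < m ] (coeff i * atDiff 0# f h (x +ℕ t i)) ∎

module GaussianBinomials {c ℓ′} (R : CommutativeRing c ℓ′) where

  open import Data.Nat using (_∸_; s≤s; _<?_) renaming (_+_ to _+ℕ_; _*_ to _*ℕ_)
  import Data.Nat.Properties as ℕ
  open import Data.Sum using (inj₁; inj₂)
  open import Relation.Nullary using (yes; no)
  open import Relation.Binary.PropositionalEquality as ≡ using (_≡_)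

  open CommutativeRing R
  open RingSums R
  open import Algebra.Solver.Ring.NaturalCoefficients.Default commutativeSemiring using (solve; _:=_; _:+_; _:*_)
  open import Relation.Binary.Reasoning.Setoid setoid

  gauss : Carrier → ℕ → ℕ → Carrier
  gauss = gaussN R

  gauss-above : ∀ Q {n j} → n < j → gauss Q n j ≈ 0#
  gauss-above Q {zero}  {suc j} _         = refl
  gauss-above Q {suc n} {suc j} (s≤s n<j) = begin
    gauss Q n j + Q ^ suc j * gauss Q n (suc j)
      ≈⟨ +-cong (gauss-above Q n<j) (*-congˡ (gauss-above Q (ℕ.m<n⇒m<1+n n<j))) ⟩
    0# + Q ^ suc j * 0#                          ≈⟨ trans (+-identityˡ _) (zeroʳ _) ⟩
    0#                                           ∎

  gauss-diag : ∀ Q n → gauss Q n n ≈ 1#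
  gauss-diag Q zero    = refl
  gauss-diag Q (suc n) = begin
    gauss Q n n + Q ^ suc n * gauss Q n (suc n) ≈⟨ +-cong (gauss-diag Q n) (*-congˡ (gauss-above Q (ℕ.n<1+n n))) ⟩
    1# + Q ^ suc n * 0#                         ≈⟨ trans (+-congˡ (zeroʳ _)) (+-identityʳ _) ⟩
    1#                                          ∎

  private
    gauss-pascal′-boundary : ∀ Q {n j} → n ≤ j → gauss Q (suc n) (suc j) ≈ Q ^ (n ∸ j) * gauss Q n j + gauss Q n (suc j)
    gauss-pascal′-boundary Q {n} {j} n≤j with ℕ.m≤n⇒m<n∨m≡n n≤j
    ... | inj₁ n<j = begin
      gauss Q (suc n) (suc j)                          ≈⟨ gauss-above Q (s≤s n<j) ⟩
      0#                                               ≈⟨ trans (+-identityʳ _) (zeroʳ _) ⟨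
      Q ^ (n ∸ j) * 0# + 0#                            ≈⟨ +-cong (*-congˡ (gauss-above Q n<j)) (gauss-above Q (ℕ.m<n⇒m<1+n n<j)) ⟨
      Q ^ (n ∸ j) * gauss Q n j + gauss Q n (suc j)    ∎
    ... | inj₂ ≡.refl = begin
      gauss Q (suc n) (suc n)                          ≈⟨ gauss-diag Q (suc n) ⟩
      1#                                               ≈⟨ trans (+-identityʳ _) (*-identityˡ 1#) ⟨
      1# * 1# + 0#
        ≈⟨ +-cong (*-cong (^-congʳ Q (ℕ.n∸n≡0 n)) (gauss-diag Q n)) (gauss-above Q (ℕ.n<1+n n)) ⟨
      Q ^ (n ∸ n) * gauss Q n n + gauss Q n (suc n)    ∎

  -- gaussN itself is defined by the other q-Pascal rule
  gauss-pascal′ : ∀ Q n j → gauss Q (suc n) (suc j) ≈ Q ^ (n ∸ j) * gauss Q n j + gauss Q n (suc j)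
  gauss-pascal′ Q n j with j <? n
  ... | no j≮n = gauss-pascal′-boundary Q (ℕ.≮⇒≥ j≮n)
  gauss-pascal′ Q (suc n) zero | yes _ = begin
    1# + Q ^ 1 * gauss Q (suc n) 1                   ≈⟨ +-congˡ (*-congˡ (gauss-pascal′ Q n 0)) ⟩
    1# + Q ^ 1 * (Q ^ n * 1# + gauss Q n 1)          ≈⟨ solve 4 (λ o x y g → o :+ x :* (y :* o :+ g) := x :* y :* o :+ (o :+ x :* g))
                                                              refl 1# (Q ^ 1) (Q ^ n) (gauss Q n 1) ⟩
    Q ^ 1 * Q ^ n * 1# + (1# + Q ^ 1 * gauss Q n 1) ≈⟨ +-congʳ (*-congʳ (^-homo-* Q 1 n)) ⟨
    Q ^ suc n * 1# + gauss Q (suc n) 1               ∎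
  gauss-pascal′ Q (suc n) (suc j) | yes (s≤s j<n) = begin
    gauss Q (suc n) (suc j) + Q ^ suc (suc j) * gauss Q (suc n) (suc (suc j))
      ≈⟨ +-cong (gauss-pascal′ Q n j) (*-congˡ (gauss-pascal′ Q n (suc j))) ⟩
    (Q ^ (n ∸ j) * g₀ + g₁) + Q ^ suc (suc j) * (Q ^ (n ∸ suc j) * g₁ + g₂)
      ≈⟨ solve 6 (λ u g₀ g₁ v w g₂ → (u :* g₀ :+ g₁) :+ v :* (w :* g₁ :+ g₂)
                                  := u :* g₀ :+ (v :* w) :* g₁ :+ (g₁ :+ v :* g₂))
                 refl (Q ^ (n ∸ j)) g₀ g₁ (Q ^ suc (suc j)) (Q ^ (n ∸ suc j)) g₂ ⟩
    Q ^ (n ∸ j) * g₀ + (Q ^ suc (suc j) * Q ^ (n ∸ suc j)) * g₁ + (g₁ + Q ^ suc (suc j) * g₂)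
      ≈⟨ +-congʳ (+-congˡ (*-congʳ exponents)) ⟩
    Q ^ (n ∸ j) * g₀ + (Q ^ (n ∸ j) * Q ^ suc j) * g₁ + (g₁ + Q ^ suc (suc j) * g₂)
      ≈⟨ solve 5 (λ u g₀ v g₁ e → u :* g₀ :+ (u :* v) :* g₁ :+ e := u :* (g₀ :+ v :* g₁) :+ e)
                 refl (Q ^ (n ∸ j)) g₀ (Q ^ suc j) g₁ _ ⟩
    Q ^ (n ∸ j) * (g₀ + Q ^ suc j * g₁) + (g₁ + Q ^ suc (suc j) * g₂) ∎
    where
    g₀ = gauss Q n j
    g₁ = gauss Q n (suc j)
    g₂ = gauss Q n (suc (suc j))
    exponents : Q ^ suc (suc j) * Q ^ (n ∸ suc j) ≈ Q ^ (n ∸ j) * Q ^ suc j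
    exponents = begin
      Q ^ suc (suc j) * Q ^ (n ∸ suc j) ≈⟨ ^-homo-* Q (suc (suc j)) (n ∸ suc j) ⟨
      Q ^ (suc (suc j) +ℕ (n ∸ suc j))  ≡⟨ ≡.cong (λ e → Q ^ suc e) (ℕ.m+[n∸m]≡n j<n) ⟩
      Q ^ suc n                         ≡⟨ ≡.cong (λ e → Q ^ suc e) (ℕ.m+[n∸m]≡n (ℕ.<⇒≤ j<n)) ⟨
      Q ^ (suc j +ℕ (n ∸ j))            ≈⟨ trans (^-homo-* Q (suc j) (n ∸ j)) (*-comm _ _) ⟩
      Q ^ (n ∸ j) * Q ^ suc j           ∎

  gauss-hockey-stick : ∀ Q s N → ∑[ y < suc N ] (Q ^ (suc s *ℕ (N ∸ y)) * gauss Q (y +ℕ s) s) ≈ gauss Q (N +ℕ suc s) (suc s)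
  gauss-hockey-stick Q s zero = begin
    0# + Q ^ (suc s *ℕ 0) * gauss Q s s ≈⟨ +-identityˡ _ ⟩
    Q ^ (suc s *ℕ 0) * gauss Q s s      ≈⟨ *-cong (^-congʳ Q (ℕ.*-zeroʳ (suc s))) (gauss-diag Q s) ⟩
    1# * 1#                             ≈⟨ *-identityˡ _ ⟩
    1#                                  ≈⟨ gauss-diag Q (suc s) ⟨
    gauss Q (suc s) (suc s)             ∎
  gauss-hockey-stick Q s (suc N) = begin
    ∑< (suc N) term + term (suc N)
      ≈⟨ +-cong (∑-cong-< (suc N) shift) last ⟩
    ∑[ y < suc N ] (Q ^ suc s * term′ y) + gauss Q (N +ℕ suc s) s
      ≈⟨ +-congʳ (∑-distribˡ-* (suc N) (Q ^ suc s) term′) ⟨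
    Q ^ suc s * ∑< (suc N) term′ + gauss Q (N +ℕ suc s) s
      ≈⟨ +-congʳ (*-congˡ (gauss-hockey-stick Q s N)) ⟩
    Q ^ suc s * gauss Q (N +ℕ suc s) (suc s) + gauss Q (N +ℕ suc s) s
      ≈⟨ +-comm _ _ ⟩
    gauss Q (N +ℕ suc s) s + Q ^ suc s * gauss Q (N +ℕ suc s) (suc s) ∎
    where
    term term′ : ℕ → Carrier
    term  y = Q ^ (suc s *ℕ (suc N ∸ y)) * gauss Q (y +ℕ s) s
    term′ y = Q ^ (suc s *ℕ (N ∸ y)) * gauss Q (y +ℕ s) s
    shift : ∀ y → y < suc N → term y ≈ Q ^ suc s * term′ y
    shift y (s≤s y≤N) = begin
      Q ^ (suc s *ℕ (suc N ∸ y)) * gauss Q (y +ℕ s) s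
        ≈⟨ *-congʳ (^-congʳ Q (≡.trans (≡.cong (suc s *ℕ_) (ℕ.+-∸-assoc 1 y≤N)) (ℕ.*-suc (suc s) (N ∸ y)))) ⟩
      Q ^ (suc s +ℕ suc s *ℕ (N ∸ y)) * gauss Q (y +ℕ s) s
        ≈⟨ trans (*-congʳ (^-homo-* Q (suc s) _)) (*-assoc _ _ _) ⟩
      Q ^ suc s * term′ y ∎
    last : term (suc N) ≈ gauss Q (N +ℕ suc s) s
    last = begin
      Q ^ (suc s *ℕ (N ∸ N)) * gauss Q (suc N +ℕ s) s
        ≈⟨ *-congʳ (^-congʳ Q (≡.trans (≡.cong (suc s *ℕ_) (ℕ.n∸n≡0 N)) (ℕ.*-zeroʳ (suc s)))) ⟩
      1# * gauss Q (suc N +ℕ s) s ≈⟨ *-identityˡ _ ⟩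
      gauss Q (suc N +ℕ s) s      ≡⟨ ≡.cong (λ n → gauss Q n s) (≡.sym (ℕ.+-suc N s)) ⟩
      gauss Q (N +ℕ suc s) s      ∎

module BoundedCompositions {c ℓ′} (R : CommutativeRing c ℓ′) where

  open import Data.Nat using (_∸_; _≤?_) renaming (_+_ to _+ℕ_; _*_ to _*ℕ_)
  import Data.Nat.Properties as ℕ
  open import Relation.Nullary using (Dec; yes; no)
  open import Relation.Binary.PropositionalEquality as ≡ using (_≡_)
  open Enumeration using (atDiff)

  open CommutativeRing R
  open import Algebra.Properties.Ring ring using (-1*x≈-x)
  open RingSums R
  open GaussianBinomials R
  open import Algebra.Solver.Ring.NaturalCoefficients.Default commutativeSemiring using (solve; _:=_; _:+_; _:*_)
  open import Relation.Binary.Reasoning.Setoid setoid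

  -- ∑ Q ^ (∑ᵢ (s ∸ 1 ∸ i) * βᵢ) over all β ∈ ℕ ^ s with ∑ β = n
  weakCompGF : Carrier → ℕ → ℕ → Carrier
  weakCompGF Q zero    zero    = 1#
  weakCompGF Q zero    (suc n) = 0#
  weakCompGF Q (suc s) n       = gauss Q (n +ℕ s) s

  -- the same sum over β ∈ {0, …, r ∸ 1} ^ s, split along the first part x = β₀
  boundedCompGF : Carrier → ℕ → ℕ → ℕ → Carrier
  boundedCompGF Q r zero    h = weakCompGF Q 0 h
  boundedCompGF Q r (suc s) h = ∑[ x < r ] (Q ^ (s *ℕ x) * atDiff 0# (boundedCompGF Q r s) h x)

  weakCompGF∸ : Carrier → ℕ → ℕ → ℕ → Carrier
  weakCompGF∸ Q s = atDiff 0# (weakCompGF Q s)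

  weakCompGF∸-pascal : ∀ Q s h t → weakCompGF∸ Q (suc s) h t ≈ weakCompGF∸ Q s h t + Q ^ s * weakCompGF∸ Q (suc s) h (suc t)
  weakCompGF∸-pascal Q s       (suc h) (suc t) = weakCompGF∸-pascal Q s h t
  weakCompGF∸-pascal Q s       zero    (suc t) = sym (trans (+-identityˡ _) (zeroʳ _))
  weakCompGF∸-pascal Q s       zero    zero    = trans (empty s) (sym (trans (+-congˡ (zeroʳ _)) (+-identityʳ _)))
    where
    empty : ∀ s → weakCompGF Q (suc s) 0 ≈ weakCompGF Q s 0
    empty zero    = refl
    empty (suc s) = trans (gauss-diag Q (suc s)) (sym (gauss-diag Q s))
  weakCompGF∸-pascal Q zero    (suc h) zero    = sym (trans (+-identityˡ _) (*-identityˡ _))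
  weakCompGF∸-pascal Q (suc s) (suc h) zero    =
    reflexive (≡.cong (λ n → gauss Q n s + Q ^ suc s * gauss Q (h +ℕ suc s) (suc s)) (ℕ.+-suc h s))

  -- the parts with β₀ ≥ r are counted by the second summand
  weakCompGF∸-telescope : ∀ Q s h t r →
    ∑[ x < r ] (Q ^ (s *ℕ x) * weakCompGF∸ Q s h (x +ℕ t)) + Q ^ (s *ℕ r) * weakCompGF∸ Q (suc s) h (r +ℕ t)
      ≈ weakCompGF∸ Q (suc s) h t
  weakCompGF∸-telescope Q s h t zero    = trans (+-identityˡ _) (trans (*-congʳ (^-congʳ Q (ℕ.*-zeroʳ s))) (*-identityˡ _))
  weakCompGF∸-telescope Q s h t (suc r) = begin
    ∑< r term + term r + Q ^ (s *ℕ suc r) * D₁ (suc r +ℕ t)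
      ≈⟨ +-congˡ (*-congʳ (trans (^-congʳ Q (ℕ.*-suc s r)) (^-homo-* Q s (s *ℕ r)))) ⟩
    ∑< r term + term r + Q ^ s * Q ^ (s *ℕ r) * D₁ (suc r +ℕ t)
      ≈⟨ solve 5 (λ a b u v d → a :+ b :+ u :* v :* d := a :+ (b :+ v :* (u :* d))) refl
                 (∑< r term) (term r) (Q ^ s) (Q ^ (s *ℕ r)) (D₁ (suc r +ℕ t)) ⟩
    ∑< r term + (Q ^ (s *ℕ r) * D₀ (r +ℕ t) + Q ^ (s *ℕ r) * (Q ^ s * D₁ (suc r +ℕ t)))
      ≈⟨ +-congˡ (trans (sym (distribˡ _ _ _)) (*-congˡ (sym (weakCompGF∸-pascal Q s h (r +ℕ t))))) ⟩
    ∑< r term + Q ^ (s *ℕ r) * D₁ (r +ℕ t)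
      ≈⟨ weakCompGF∸-telescope Q s h t r ⟩
    D₁ t ∎
    where
    D₀ D₁ term : ℕ → Carrier
    D₀ = weakCompGF∸ Q s h
    D₁ = weakCompGF∸ Q (suc s) h
    term x = Q ^ (s *ℕ x) * D₀ (x +ℕ t)

  triangle : ℕ → ℕ
  triangle zero    = 0
  triangle (suc i) = triangle i +ℕ i

  ieCoeff : Carrier → ℕ → ℕ → Carrier
  ieCoeff P s i = (- 1#) ^ i * P ^ triangle i * gauss P s i

  ieCoeff-pascal : ∀ P s i → ieCoeff P (suc s) (suc i) ≈ ieCoeff P s (suc i) + - 1# * (P ^ s * ieCoeff P s i)
  ieCoeff-pascal P s i = begin
    - 1# * σ * P ^ (triangle i +ℕ i) * gauss P (suc s) (suc i)
      ≈⟨ *-cong (*-congˡ (^-homo-* P (triangle i) i)) (gauss-pascal′ P s i) ⟩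
    - 1# * σ * (τ * P ^ i) * (P ^ (s ∸ i) * g₀ + g₁)
      ≈⟨ solve 7 (λ n σ τ π ρ g₀ g₁ → n :* σ :* (τ :* π) :* (ρ :* g₀ :+ g₁)
                                     := n :* σ :* (τ :* π) :* g₁ :+ n :* ((π :* ρ) :* (σ :* τ :* g₀)))
                 refl (- 1#) σ τ (P ^ i) (P ^ (s ∸ i)) g₀ g₁ ⟩
    - 1# * σ * (τ * P ^ i) * g₁ + - 1# * ((P ^ i * P ^ (s ∸ i)) * (σ * τ * g₀))
      ≈⟨ +-cong (*-congʳ (*-congˡ (sym (^-homo-* P (triangle i) i)))) (*-congˡ (*-congʳ (sym (^-homo-* P i (s ∸ i))))) ⟩
    - 1# * σ * P ^ (triangle i +ℕ i) * g₁ + - 1# * (P ^ (i +ℕ (s ∸ i)) * (σ * τ * g₀))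
      ≈⟨ +-congˡ (*-congˡ (lowerExponent (i ≤? s))) ⟩
    - 1# * σ * P ^ (triangle i +ℕ i) * g₁ + - 1# * (P ^ s * (σ * τ * g₀)) ∎
    where
    σ = (- 1#) ^ i
    τ = P ^ triangle i
    g₀ = gauss P s i
    g₁ = gauss P s (suc i)
    -- i + (s ∸ i) ≡ s fails only when i > s, and then g₀ vanishes
    lowerExponent : Dec (i ≤ s) → P ^ (i +ℕ (s ∸ i)) * (σ * τ * g₀) ≈ P ^ s * (σ * τ * g₀)
    lowerExponent (yes i≤s) = *-congʳ (^-congʳ P (ℕ.m+[n∸m]≡n i≤s))
    lowerExponent (no i≰s)  = trans (vanishes _) (sym (vanishes _))
      where
      vanishes : ∀ x → x * (σ * τ * g₀) ≈ 0#
      vanishes x = trans (*-congˡ (trans (*-congˡ (gauss-above P (ℕ.≰⇒> i≰s))) (zeroʳ _))) (zeroʳ x)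

  ieCoeff-sum-step : ∀ P s (F : ℕ → Carrier) →
    ∑[ i < suc (suc s) ] (ieCoeff P (suc s) i * F i) ≈ ∑[ i < suc s ] (ieCoeff P s i * (F i + - 1# * (P ^ s * F (suc i))))
  ieCoeff-sum-step P s F = begin
    ∑[ i < suc (suc s) ] (ieCoeff P (suc s) i * F i)
      ≈⟨ ∑-first (suc s) _ ⟩
    ieCoeff P (suc s) 0 * F 0 + ∑[ i < suc s ] (ieCoeff P (suc s) (suc i) * F (suc i))
      ≈⟨ +-congˡ (∑-cong (suc s) (λ i → trans (*-congʳ (ieCoeff-pascal P s i)) (distribʳ _ _ _))) ⟩
    A 0 + ∑[ i < suc s ] (C i + B i)
      ≈⟨ +-congˡ (∑-distrib-+ (suc s) C B) ⟩
    A 0 + (∑< s C + C s + ∑< (suc s) B)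
      ≈⟨ +-congˡ (+-congʳ (trans (+-congˡ C-last≈0) (+-identityʳ _))) ⟩
    A 0 + (∑< s C + ∑< (suc s) B)
      ≈⟨ trans (sym (+-assoc _ _ _)) (+-congʳ (sym (∑-first s A))) ⟩
    ∑< (suc s) A + ∑< (suc s) B
      ≈⟨ ∑-distrib-+ (suc s) A B ⟨
    ∑[ i < suc s ] (A i + B i)
      ≈⟨ ∑-cong (suc s) (λ i → trans (+-congˡ (rearrange i))
                                     (solve 4 (λ c f n g → c :* f :+ n :* g :* c := c :* (f :+ n :* g))
                                              refl (ieCoeff P s i) (F i) (- 1#) (P ^ s * F (suc i)))) ⟩
    ∑[ i < suc s ] (ieCoeff P s i * (F i + - 1# * (P ^ s * F (suc i)))) ∎
    where
    A B C : ℕ → Carrier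
    A i = ieCoeff P s i * F i
    B i = - 1# * (P ^ s * ieCoeff P s i) * F (suc i)
    C i = ieCoeff P s (suc i) * F (suc i)
    C-last≈0 : C s ≈ 0#
    C-last≈0 = trans (*-congʳ (trans (*-congˡ (gauss-above P (ℕ.n<1+n s))) (zeroʳ _))) (zeroˡ _)
    rearrange : ∀ i → B i ≈ - 1# * (P ^ s * F (suc i)) * ieCoeff P s i
    rearrange i = solve 4 (λ n p c f → n :* (p :* c) :* f := n :* (p :* f) :* c) refl (- 1#) (P ^ s) (ieCoeff P s i) (F (suc i))

  x+y≈z⇒x≈z+[-1]*y : ∀ {x y z} → x + y ≈ z → x ≈ z + - 1# * y
  x+y≈z⇒x≈z+[-1]*y {x} {y} {z} x+y≈z = begin
    x                      ≈⟨ +-identityʳ x ⟨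
    x + 0#                 ≈⟨ +-congˡ (trans (+-congˡ (-1*x≈-x y)) (-‿inverseʳ y)) ⟨
    x + (y + - 1# * y)     ≈⟨ +-assoc _ _ _ ⟨
    x + y + - 1# * y       ≈⟨ +-congʳ x+y≈z ⟩
    z + - 1# * y           ∎

  boundedCompGF-inclusion-exclusion : ∀ Q r s h →
    boundedCompGF Q r s h ≈ ∑[ i < suc s ] (ieCoeff (Q ^ r) s i * weakCompGF∸ Q s h (r *ℕ i))
  boundedCompGF-inclusion-exclusion Q r zero h = sym (begin
    0# + ieCoeff (Q ^ r) 0 0 * weakCompGF∸ Q 0 h (r *ℕ 0) ≈⟨ +-identityˡ _ ⟩
    ieCoeff (Q ^ r) 0 0 * weakCompGF∸ Q 0 h (r *ℕ 0)
      ≈⟨ *-cong (trans (*-identityʳ _) (*-identityˡ _)) (reflexive (≡.cong (weakCompGF∸ Q 0 h) (ℕ.*-zeroʳ r))) ⟩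
    1# * weakCompGF Q 0 h                                  ≈⟨ *-identityˡ _ ⟩
    weakCompGF Q 0 h                                       ∎)
  boundedCompGF-inclusion-exclusion Q r (suc s) h = begin
    ∑[ x < r ] (Q ^ (s *ℕ x) * atDiff 0# (boundedCompGF Q r s) h x)
      ≈⟨ ∑-cong r (λ x → *-congˡ (atDiff-expansion (suc s) coeff (weakCompGF Q s) (r *ℕ_)
                                                     (boundedCompGF-inclusion-exclusion Q r s) h x)) ⟩
    ∑[ x < r ] (Q ^ (s *ℕ x) * ∑[ i < suc s ] (coeff i * D₀ (x +ℕ r *ℕ i)))
      ≈⟨ ∑-cong r (λ x → trans (∑-distribˡ-* (suc s) _ _) (∑-cong (suc s) (λ i → x*[y*z]≈y*[x*z] _ _ _))) ⟩
    ∑[ x < r ] ∑[ i < suc s ] (coeff i * (Q ^ (s *ℕ x) * D₀ (x +ℕ r *ℕ i)))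
      ≈⟨ ∑-comm r (suc s) _ ⟩
    ∑[ i < suc s ] ∑[ x < r ] (coeff i * (Q ^ (s *ℕ x) * D₀ (x +ℕ r *ℕ i)))
      ≈⟨ ∑-cong (suc s) (λ i → ∑-distribˡ-* r (coeff i) _) ⟨
    ∑[ i < suc s ] (coeff i * ∑[ x < r ] (Q ^ (s *ℕ x) * D₀ (x +ℕ r *ℕ i)))
      ≈⟨ ∑-cong (suc s) (λ i → *-congˡ (telescoped i)) ⟩
    ∑[ i < suc s ] (coeff i * (D₁ (r *ℕ i) + - 1# * (P ^ s * D₁ (r *ℕ suc i))))
      ≈⟨ ieCoeff-sum-step P s (λ i → D₁ (r *ℕ i)) ⟨
    ∑[ i < suc (suc s) ] (ieCoeff P (suc s) i * D₁ (r *ℕ i)) ∎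
    where
    P = Q ^ r
    coeff D₀ D₁ : ℕ → Carrier
    coeff  = ieCoeff P s
    D₀ = weakCompGF∸ Q s h
    D₁ = weakCompGF∸ Q (suc s) h
    x*[y*z]≈y*[x*z] : ∀ x y z → x * (y * z) ≈ y * (x * z)
    x*[y*z]≈y*[x*z] = solve 3 (λ x y z → x :* (y :* z) := y :* (x :* z)) refl
    telescoped : ∀ i → ∑[ x < r ] (Q ^ (s *ℕ x) * D₀ (x +ℕ r *ℕ i)) ≈ D₁ (r *ℕ i) + - 1# * (P ^ s * D₁ (r *ℕ suc i))
    telescoped i = trans (x+y≈z⇒x≈z+[-1]*y (weakCompGF∸-telescope Q s h (r *ℕ i) r))
                         (+-congˡ (*-congˡ (*-cong (trans (^-congʳ Q (ℕ.*-comm s r)) (sym (^-assocʳ Q r s)))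
                                                   (reflexive (≡.cong D₁ (≡.sym (ℕ.*-suc r i)))))))

module QBinomials {c ℓ′} (R : CommutativeRing c ℓ′) where

  open import Data.Nat using (_∸_; _/_; _≤?_) renaming (_+_ to _+ℕ_; _*_ to _*ℕ_)
  import Data.Nat.Properties as ℕ
  open import Data.Nat.DivMod using (m*n/n≡m)
  open import Data.Nat.Solver using (module +-*-Solver)
  open import Data.Integer as ℤ using (+_; _⊖_)
  import Data.Integer.Properties as ℤ
  import Data.Integer.Solver as ℤ-Solver
  open import Relation.Nullary using (yes; no)
  open import Relation.Binary.PropositionalEquality as ≡ using (_≡_)
  open Enumeration using (atDiff; atDiff-≤; atDiff->)

  open CommutativeRing R
  open RingSums R
  open GaussianBinomials R
  open BoundedCompositions R

  gauss-congˡ : ∀ {P P′} → P ≈ P′ → ∀ n j → gauss P n j ≈ gauss P′ n j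
  gauss-congˡ P≈P′ n       zero    = refl
  gauss-congˡ P≈P′ zero    (suc j) = refl
  gauss-congˡ P≈P′ (suc n) (suc j) = +-cong (gauss-congˡ P≈P′ n j) (*-cong (^-congˡ (suc j) P≈P′) (gauss-congˡ P≈P′ n (suc j)))

  module _ (q : Carrier) (κ : ℕ) where

    qbin-⊖-≥ : ∀ {x y} j → y ≤ x → qbin R q κ (x ⊖ y) (+ j) ≈ gauss (q ^ κ) (x ∸ y) j
    qbin-⊖-≥ j y≤x = reflexive (≡.cong (λ z → qbin R q κ z (+ j)) (ℤ.⊖-≥ y≤x))

    qbin-⊖-< : ∀ {x y} j → x < y → qbin R q κ (x ⊖ y) (+ j) ≈ 0#
    qbin-⊖-< {x} {y} j x<y with y ∸ x | ℕ.m<n⇒0<n∸m x<y | ℤ.⊖-< x<y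
    ... | suc _ | _ | x⊖y≡ = reflexive (≡.cong (λ z → qbin R q κ z (+ j)) x⊖y≡)

    qbin-⊖-small : ∀ {x y} j → x < y +ℕ j → qbin R q κ (x ⊖ y) (+ j) ≈ 0#
    qbin-⊖-small {x} {y} j x<y+j with y ≤? x
    ... | no y≰x  = qbin-⊖-< j (ℕ.≰⇒> y≰x)
    ... | yes y≤x = trans (qbin-⊖-≥ j y≤x) (gauss-above (q ^ κ)
                      (ℕ.+-cancelˡ-< y (x ∸ y) j (≡.subst (_< y +ℕ j) (≡.sym (ℕ.m+[n∸m]≡n y≤x)) x<y+j)))

  private
    i*i≡triangle+triangle+i : ∀ i → i *ℕ i ≡ triangle i +ℕ triangle i +ℕ i
    i*i≡triangle+triangle+i zero    = ≡.refl
    i*i≡triangle+triangle+i (suc i) = begin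
      suc i +ℕ i *ℕ suc i                              ≡⟨ ≡.cong (suc i +ℕ_) (ℕ.*-suc i i) ⟩
      suc i +ℕ (i +ℕ i *ℕ i)                           ≡⟨ ≡.cong (λ n → suc i +ℕ (i +ℕ n)) (i*i≡triangle+triangle+i i) ⟩
      suc i +ℕ (i +ℕ (triangle i +ℕ triangle i +ℕ i))
        ≡⟨ solve 2 (λ i t → con 1 :+ i :+ (i :+ (t :+ t :+ i)) := t :+ i :+ (t :+ i) :+ (con 1 :+ i)) ≡.refl i (triangle i) ⟩
      triangle (suc i) +ℕ triangle (suc i) +ℕ suc i    ∎
      where open ≡.≡-Reasoning
            open +-*-Solver

  i*i∸i≡triangle+triangle : ∀ i → i *ℕ i ∸ i ≡ triangle i +ℕ triangle i
  i*i∸i≡triangle+triangle i = ≡.trans (≡.cong (_∸ i) (i*i≡triangle+triangle+i i)) (ℕ.m+n∸n≡m _ i)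

  private
    halved-exponent : ∀ k r i → (r *ℕ k *ℕ (i *ℕ i ∸ i)) / 2 ≡ k *ℕ (r *ℕ triangle i)
    halved-exponent k r i = begin
      (r *ℕ k *ℕ (i *ℕ i ∸ i)) / 2                       ≡⟨ ≡.cong (λ n → (r *ℕ k *ℕ n) / 2) (i*i∸i≡triangle+triangle i) ⟩
      (r *ℕ k *ℕ (triangle i +ℕ triangle i)) / 2
        ≡⟨ ≡.cong (_/ 2) (solve 3 (λ r k t → r :* k :* (t :+ t) := k :* (r :* t) :* con 2) ≡.refl r k (triangle i)) ⟩
      k *ℕ (r *ℕ triangle i) *ℕ 2 / 2                     ≡⟨ m*n/n≡m (k *ℕ (r *ℕ triangle i)) 2 ⟩
      k *ℕ (r *ℕ triangle i)                              ∎
      where open ≡.≡-Reasoning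
            open +-*-Solver

    second-argument : ∀ h u s → + h ℤ.- + u ℤ.+ + suc s ℤ.- + 1 ≡ (h +ℕ s) ⊖ u
    second-argument h u s = ≡.trans (solve 3 (λ h u s → h :- u :+ (con (+ 1) :+ s) :- con (+ 1) := (h :+ s) :- u) ≡.refl (+ h) (+ u) (+ s))
                                    (ℤ.[+m]-[+n]≡m⊖n (h +ℕ s) u)
      where open ℤ-Solver.+-*-Solver

  g≈boundedCompGF : ∀ q k r h s → g R q k r h (suc s) ≈ boundedCompGF (q ^ k) r (suc s) h
  g≈boundedCompGF q k r h s = trans (∑-cong (suc (suc s)) term) (sym (boundedCompGF-inclusion-exclusion Q r (suc s) h))
    where
    Q = q ^ k
    P = Q ^ r
    term : ∀ i → (- 1#) ^ i * q ^ ((r *ℕ k *ℕ (i *ℕ i ∸ i)) / 2) * qbin R q (r *ℕ k) (+ suc s) (+ i)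
                   * qbin R q k (+ h ℤ.- + (r *ℕ i) ℤ.+ + suc s ℤ.- + 1) (+ s)
                 ≈ ieCoeff P (suc s) i * weakCompGF∸ Q (suc s) h (r *ℕ i)
    term i = *-cong (*-cong (*-congˡ power-factor) first-binomial) second-binomial
      where
      power-factor : q ^ ((r *ℕ k *ℕ (i *ℕ i ∸ i)) / 2) ≈ P ^ triangle i
      power-factor = trans (^-congʳ q (halved-exponent k r i)) (sym (trans (^-assocʳ Q r (triangle i)) (^-assocʳ q k (r *ℕ triangle i))))
      first-binomial : gauss (q ^ (r *ℕ k)) (suc s) i ≈ gauss P (suc s) i
      first-binomial = gauss-congˡ (sym (trans (^-assocʳ q k r) (^-congʳ q (ℕ.*-comm k r)))) (suc s) i
      second-binomial : qbin R q k (+ h ℤ.- + (r *ℕ i) ℤ.+ + suc s ℤ.- + 1) (+ s) ≈ weakCompGF∸ Q (suc s) h (r *ℕ i)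
      second-binomial rewrite second-argument h (r *ℕ i) s with r *ℕ i ≤? h
      ... | yes ri≤h = trans (qbin-⊖-≥ q k s (ℕ.≤-trans ri≤h (ℕ.m≤m+n h s)))
                             (sym (trans (reflexive (atDiff-≤ 0# (weakCompGF Q (suc s)) ri≤h))
                                         (reflexive (≡.cong (λ n → gauss Q n s) (≡.sym (ℕ.+-∸-comm s ri≤h))))))
      ... | no ri≰h  = trans (qbin-⊖-small q k s (ℕ.+-monoˡ-< s (ℕ.≰⇒> ri≰h)))
                             (sym (reflexive (atDiff-> 0# (weakCompGF Q (suc s)) (ℕ.≰⇒> ri≰h))))

  private
    rhs-argument : ∀ m h s → + m ℤ.- + h ℤ.- + s ℤ.+ + 1 ≡ suc m ⊖ (h +ℕ s)
    rhs-argument m h s = ≡.trans (solve 3 (λ m h s → m :- h :- s :+ con (+ 1) := (con (+ 1) :+ m) :- (h :+ s)) ≡.refl (+ m) (+ h) (+ s))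
                                 (ℤ.[+m]-[+n]≡m⊖n (suc m) (h +ℕ s))
      where open ℤ-Solver.+-*-Solver

  -- the Gaussian factor of the (s, h) summand of rhs, as a function of N = m + 1 - (h + 2 s)
  qbin-rhs : ∀ q k m h s → qbin R q k (+ m ℤ.- + h ℤ.- + s ℤ.+ + 1) (+ s)
                           ≈ atDiff 0# (λ N → gauss (q ^ k) (N +ℕ s) s) (suc m) (h +ℕ s +ℕ s)
  qbin-rhs q k m h s rewrite rhs-argument m h s with h +ℕ s +ℕ s ≤? suc m
  ... | yes D≤1+m = trans (qbin-⊖-≥ q k s (ℕ.≤-trans (ℕ.m≤m+n (h +ℕ s) s) D≤1+m))
                          (reflexive (≡.sym (≡.trans (atDiff-≤ 0# _ D≤1+m) (≡.cong (λ n → gauss (q ^ k) n s) N+s≡))))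
    where
    N+s≡ : suc m ∸ (h +ℕ s +ℕ s) +ℕ s ≡ suc m ∸ (h +ℕ s)
    N+s≡ = ≡.trans (≡.cong (_+ℕ s) (≡.sym (ℕ.∸-+-assoc (suc m) (h +ℕ s) s)))
                   (ℕ.m∸n+n≡m (ℕ.m+n≤o⇒m≤o∸n s (≡.subst (_≤ suc m) (ℕ.+-comm (h +ℕ s) s) D≤1+m)))
  ... | no D≰1+m = trans (qbin-⊖-small q k s (ℕ.≰⇒> D≰1+m))
                         (sym (reflexive (atDiff-> 0# _ (ℕ.≰⇒> D≰1+m))))

module Levels (a b k : ℕ) .{{_ : NonZero k}} (1≤a : 1 ≤ a) (a<b : a < b) (b≤k : b ≤ k) where

  open import Data.Nat using (_+_; _*_; _∸_; _/_; z≤n)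
  open import Data.Nat.DivMod using (_%_; m≡m%n+[m/n]*n; [m+n]%n≡m%n)
  open import Data.Nat.Properties
  open import Data.Sum using (_⊎_; inj₁; inj₂)
  open import Relation.Binary.PropositionalEquality using (_≡_; _≢_; refl; sym; trans; cong; subst)
  open ≤-Reasoning

  aLevel bLevel : ℕ → ℕ
  aLevel zero    = a
  aLevel (suc j) = k + aLevel j
  bLevel zero    = b
  bLevel (suc j) = k + bLevel j

  aLevel<bLevel : ∀ j → aLevel j < bLevel j
  aLevel<bLevel zero    = a<b
  aLevel<bLevel (suc j) = +-monoʳ-< k (aLevel<bLevel j)

  bLevel<aLevel : ∀ j → bLevel j < aLevel (suc j)
  bLevel<aLevel zero    = ≤-<-trans b≤k (m<m+n k 1≤a)
  bLevel<aLevel (suc j) = +-monoʳ-< k (bLevel<aLevel j)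

  aLevel<aLevel : ∀ j → aLevel j < aLevel (suc j)
  aLevel<aLevel j = <-trans (aLevel<bLevel j) (bLevel<aLevel j)

  private
    k+x%k≡x%k : ∀ x → (k + x) % k ≡ x % k
    k+x%k≡x%k x = trans (cong (_% k) (+-comm k x)) ([m+n]%n≡m%n x k)

  aLevel-residue : ∀ j → aLevel j % k ≡ a % k
  aLevel-residue zero    = refl
  aLevel-residue (suc j) = trans (k+x%k≡x%k (aLevel j)) (aLevel-residue j)

  bLevel-residue : ∀ j → bLevel j % k ≡ b % k
  bLevel-residue zero    = refl
  bLevel-residue (suc j) = trans (k+x%k≡x%k (bLevel j)) (bLevel-residue j)

  private
    ≤-window : ∀ {x y} → x % k ≡ y % k → x ≤ y → y < x + k → x ≡ y
    ≤-window {x} {y} x≡y x≤y y<x+k = ≤-antisym x≤y y≤x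
      where
      y/k≤x/k : y / k ≤ x / k
      y/k≤x/k = ≮⇒≥ λ x/k<y/k → <⇒≱ y<x+k (begin
        x + k                      ≡⟨ cong (_+ k) (m≡m%n+[m/n]*n x k) ⟩
        x % k + x / k * k + k      ≡⟨ +-assoc (x % k) _ k ⟩
        x % k + (x / k * k + k)    ≡⟨ cong (x % k +_) (+-comm _ k) ⟩
        x % k + suc (x / k) * k    ≤⟨ +-mono-≤ (≤-reflexive x≡y) (*-monoˡ-≤ k x/k<y/k) ⟩
        y % k + y / k * k          ≡⟨ m≡m%n+[m/n]*n y k ⟨
        y                          ∎)
      y≤x : y ≤ x
      y≤x = begin
        y                          ≡⟨ m≡m%n+[m/n]*n y k ⟩
        y % k + y / k * k          ≤⟨ +-mono-≤ (≤-reflexive (sym x≡y)) (*-monoˡ-≤ k y/k≤x/k) ⟩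
        x % k + x / k * k          ≡⟨ m≡m%n+[m/n]*n x k ⟨
        x                          ∎

  %-injective-window : ∀ {x y} → x % k ≡ y % k → x < y + k → y < x + k → x ≡ y
  %-injective-window {x} {y} x≡y x<y+k y<x+k with ≤-total x y
  ... | inj₁ x≤y = ≤-window x≡y x≤y y<x+k
  ... | inj₂ y≤x = sym (≤-window (sym x≡y) y≤x x<y+k)

  a≢b-mod-k : a % k ≢ b % k
  a≢b-mod-k a≡b = <⇒≢ a<b (%-injective-window a≡b (≤-trans a<b (m≤m+n b k)) (≤-<-trans b≤k (m<n+m k 1≤a)))

  ResidueAB : ℕ → Set
  ResidueAB x = x % k ≡ a % k ⊎ x % k ≡ b % k

  0<k : 0 < k
  0<k = <-≤-trans (≤-<-trans z≤n a<b) b≤k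

  private
    below-window : ∀ {x y} → y ≤ x → x ∸ y < k → x < y + k
    below-window {x} {y} y≤x x∸y<k = begin-strict
      x           ≡⟨ m∸n+n≡m y≤x ⟨
      x ∸ y + y   <⟨ +-monoˡ-< y x∸y<k ⟩
      k + y       ≡⟨ +-comm k y ⟩
      y + k       ∎

    above-window : ∀ {x y} → y ≤ x → y < x + k
    above-window {x} y≤x = ≤-<-trans y≤x (m<m+n x 0<k)

    bLevel<aLevel+k : ∀ j → bLevel j < aLevel j + k
    bLevel<aLevel+k j = subst (bLevel j <_) (+-comm k (aLevel j)) (bLevel<aLevel j)

    aLevel<bLevel+k : ∀ j → aLevel (suc j) < bLevel j + k
    aLevel<bLevel+k j = subst (_< bLevel j + k) (+-comm (aLevel j) k) (+-monoˡ-< k (aLevel<bLevel j))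

  aLevel→bLevel-gap : ∀ j → bLevel j ∸ aLevel j < k
  aLevel→bLevel-gap j = m<n+o⇒m∸n<o (bLevel j) (aLevel j) (bLevel<aLevel+k j)

  bLevel→aLevel-gap : ∀ j → aLevel (suc j) ∸ bLevel j < k
  bLevel→aLevel-gap j = m<n+o⇒m∸n<o (aLevel (suc j)) (bLevel j) (aLevel<bLevel+k j)

  -- each of the residues a and b occurs only once in a window of length k
  aLevel-successor : ∀ j {x} → aLevel j ≤ x → x ∸ aLevel j < k → ResidueAB x → x ≡ aLevel j ⊎ x ≡ bLevel j
  aLevel-successor j aⱼ≤x gap (inj₁ x≡a) =
    inj₁ (%-injective-window (trans x≡a (sym (aLevel-residue j))) (below-window aⱼ≤x gap) (above-window aⱼ≤x))
  aLevel-successor j {x} aⱼ≤x gap (inj₂ x≡b) =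
    inj₂ (%-injective-window (trans x≡b (sym (bLevel-residue j)))
           (<-trans (below-window aⱼ≤x gap) (+-monoˡ-< k (aLevel<bLevel j)))
           (<-≤-trans (bLevel<aLevel+k j) (+-monoˡ-≤ k aⱼ≤x)))

  bLevel-successor : ∀ j {x} → bLevel j ≤ x → x ∸ bLevel j < k → ResidueAB x → x ≡ bLevel j ⊎ x ≡ aLevel (suc j)
  bLevel-successor j {x} bⱼ≤x gap (inj₁ x≡a) =
    inj₂ (%-injective-window (trans x≡a (sym (aLevel-residue (suc j))))
           (<-trans (below-window bⱼ≤x gap) (+-monoˡ-< k (bLevel<aLevel j)))
           (<-≤-trans (aLevel<bLevel+k j) (+-monoˡ-≤ k bⱼ≤x)))
  bLevel-successor j bⱼ≤x gap (inj₂ x≡b) =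
    inj₁ (%-injective-window (trans x≡b (sym (bLevel-residue j))) (below-window bⱼ≤x gap) (above-window bⱼ≤x))

module Profiles (a b k r : ℕ) .{{_ : NonZero k}} (1≤a : 1 ≤ a) (a<b : a < b) (b≤k : b ≤ k) (1≤r : 1 ≤ r) where

  open import Data.Nat using (_+_; _∸_; z≤n; s≤s; _<?_)
  open import Data.Nat.DivMod using (_%_)
  open import Data.Nat.ListAction using (sum)
  open import Data.Nat.Properties
  open import Data.Nat.Solver using (module +-*-Solver)
  open +-*-Solver using (solve; _:=_; _:+_; con)
  open import Data.List using ([]; _∷_; _++_; length; replicate; map; cartesianProduct)
  open import Data.List.Properties using (length-++; length-replicate; ∷-injectiveˡ; ∷-injectiveʳ)
  open import Data.List.Membership.Propositional using (_∉_)
  open import Data.List.Membership.Propositional.Properties using (∈-map⁺; ∈-map⁻; ∈-cartesianProduct⁺; ∈-cartesianProduct⁻)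
  open import Data.List.Relation.Unary.All as All using (All; []; _∷_)
  import Data.List.Relation.Unary.All.Properties as All
  open import Data.List.Relation.Unary.AllPairs using ([]; _∷_)
  open import Data.List.Relation.Unary.Any using (here; there)
  import Data.List.Relation.Unary.Unique.Propositional.Properties as Unique
  open import Data.Empty using (⊥-elim)
  open import Data.Product using (_×_; _,_; proj₂; ∃; ∃₂)
  open import Data.Sum using (_⊎_; inj₁; inj₂)
  open import Data.Unit using (⊤; tt)
  open import Relation.Nullary using (yes; no)
  open import Function.Bundles using (mk⇔)
  open import Relation.Binary.PropositionalEquality
  open Levels a b k 1≤a a<b b≤k public
  open Enumeration

  InBP : ℕ → List ℕ → Set
  InBP m = BP a b k r m

  record CanPrepend (m x : ℕ) (π : List ℕ) : Set where
    field
      above   : at π 0 ≤ x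
      residue : ResidueAB x
      gap     : x ∸ at π 0 < k
      run     : r < suc m → (∀ t → t < r → at π t ≡ at π 0) → at π 0 % k ≡ b % k → x % k ≡ a % k

  BP-uncons : ∀ {m x π} → InBP (suc (suc m)) (x ∷ π) → InBP (suc m) π × CanPrepend (suc m) x π
  BP-uncons bp = record
    { len      = suc-injective (BP.len bp)
    ; positive = λ j j<m → BP.positive bp (suc j) (s≤s j<m)
    ; nonincr  = λ j j<m → BP.nonincr bp (suc j) (s≤s j<m)
    ; residues = λ j j<m → BP.residues bp (suc j) (s≤s j<m)
    ; lastPart = BP.lastPart bp
    ; gaps     = λ j j<m → BP.gaps bp (suc j) (s≤s j<m)
    ; runs     = λ j j<m → BP.runs bp (suc j) (s≤s j<m)
    } , record
    { above   = BP.nonincr bp 0 (s≤s (s≤s z≤n))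
    ; residue = BP.residues bp 0 (s≤s z≤n)
    ; gap     = BP.gaps bp 0 (s≤s (s≤s z≤n))
    ; run     = BP.runs bp 0
    }

  BP-cons : ∀ {m x π} → InBP (suc m) π → CanPrepend (suc m) x π → InBP (suc (suc m)) (x ∷ π)
  BP-cons {m} {x} {π} bp cp = record
    { len      = cong suc (BP.len bp)
    ; positive = λ { zero _ → ≤-trans (BP.positive bp 0 (s≤s z≤n)) above ; (suc j) (s≤s j<m) → BP.positive bp j j<m }
    ; nonincr  = λ { zero _ → above ; (suc j) (s≤s j<m) → BP.nonincr bp j j<m }
    ; residues = λ { zero _ → residue ; (suc j) (s≤s j<m) → BP.residues bp j j<m }
    ; lastPart = BP.lastPart bp
    ; gaps     = λ { zero _ → gap ; (suc j) (s≤s j<m) → BP.gaps bp j j<m }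
    ; runs     = λ { zero j<m → run j<m ; (suc j) (s≤s j<m) → BP.runs bp j j<m }
    }
    where open CanPrepend cp

  BP-one⁻ : ∀ {π} → InBP 1 π → π ≡ a ∷ [] ⊎ π ≡ b ∷ []
  BP-one⁻ {[]}         bp with () ← BP.len bp
  BP-one⁻ {_ ∷ _ ∷ _}  bp with () ← BP.len bp
  BP-one⁻ {x ∷ []}     bp with BP.lastPart bp
  ... | inj₁ refl = inj₁ refl
  ... | inj₂ refl = inj₂ refl

  BP-one⁺ : ∀ {x} → x ≡ a ⊎ x ≡ b → InBP 1 (x ∷ [])
  BP-one⁺ {x} x≡a∨b = record
    { len      = refl
    ; positive = λ { zero _ → positive x≡a∨b ; (suc _) (s≤s ()) }
    ; nonincr  = λ { _ (s≤s ()) }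
    ; residues = λ { zero _ → residue x≡a∨b ; (suc _) (s≤s ()) }
    ; lastPart = x≡a∨b
    ; gaps     = λ { _ (s≤s ()) }
    ; runs     = λ j j+r<1 → ⊥-elim (<⇒≱ j+r<1 (≤-trans 1≤r (m≤n+m r j)))
    }
    where
    positive : x ≡ a ⊎ x ≡ b → 1 ≤ x
    positive (inj₁ refl) = 1≤a
    positive (inj₂ refl) = ≤-trans 1≤a (<⇒≤ a<b)
    residue : x ≡ a ⊎ x ≡ b → ResidueAB x
    residue (inj₁ refl) = inj₁ refl
    residue (inj₂ refl) = inj₂ refl

  record Profile : Set where
    constructor profile
    field
      height : ℕ
      aMults : List ℕ
      bMults : List ℕ

  open Profile

  -- a-levels strictly between two b-levels must occur; the bottom level a need not
  aFloor : ℕ → ℕ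
  aFloor zero    = 0
  aFloor (suc _) = 1

  -- Read from the top, profile s α β has α₀ parts aLevel s, then 1 + β₀ parts bLevel (s ∸ 1),
  -- 1 + α₁ parts aLevel (s ∸ 1), …, 1 + β_(s-1) parts b, and finally α_s parts a.
  mutual
    partsFromA : ℕ → ℕ → List ℕ → List ℕ → List ℕ
    partsFromA j e []       βs = []
    partsFromA j e (x ∷ αs) βs = replicate (x + e) (aLevel j) ++ partsFromB j αs βs

    partsFromB : ℕ → List ℕ → List ℕ → List ℕ
    partsFromB zero    αs βs       = []
    partsFromB (suc j) αs []       = []
    partsFromB (suc j) αs (y ∷ βs) = replicate (suc y) (bLevel j) ++ partsFromA j (aFloor j) αs βs

  parts : Profile → List ℕ
  parts (profile s α β) = partsFromA s 0 α β

  partCount : Profile → ℕ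
  partCount (profile s α β) = s + (s ∸ 1) + sum α + sum β

  record Valid (m : ℕ) (t : Profile) : Set where
    constructor valid
    field
      aMults-length  : length (aMults t) ≡ suc (height t)
      bMults-length  : length (bMults t) ≡ height t
      bMults-bounded : All (_< r) (bMults t)
      partCount≡     : partCount t ≡ m

  private
    length-replicate-++ : ∀ n (v : ℕ) xs → length (replicate n v ++ xs) ≡ n + length xs
    length-replicate-++ n v xs = trans (length-++ (replicate n v)) (cong (_+ length xs) (length-replicate n))

    aFloor+pred : ∀ j → aFloor j + (j ∸ 1) ≡ j
    aFloor+pred zero    = refl
    aFloor+pred (suc j) = refl

  length-partsFromA : ∀ j e α β → length α ≡ suc j → length β ≡ j →
                      length (partsFromA j e α β) ≡ e + (j + (j ∸ 1)) + sum α + sum β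
  length-partsFromA zero    e (x ∷ []) [] _ _ =
    trans (length-replicate-++ (x + e) a []) (solve 2 (λ x e → x :+ e :+ con 0 := e :+ con 0 :+ (x :+ con 0) :+ con 0) refl x e)
  length-partsFromA (suc j) e (x ∷ αs) (y ∷ βs) αs-length βs-length = begin
    length (replicate (x + e) (aLevel (suc j)) ++ (replicate (suc y) (bLevel j) ++ partsFromA j (aFloor j) αs βs))
      ≡⟨ length-replicate-++ (x + e) _ _ ⟩
    x + e + length (replicate (suc y) (bLevel j) ++ partsFromA j (aFloor j) αs βs)
      ≡⟨ cong (x + e +_) (length-replicate-++ (suc y) _ _) ⟩
    x + e + (suc y + length (partsFromA j (aFloor j) αs βs))
      ≡⟨ cong (λ n → x + e + (suc y + n)) (length-partsFromA j (aFloor j) αs βs (suc-injective αs-length) (suc-injective βs-length)) ⟩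
    x + e + (suc y + (aFloor j + (j + (j ∸ 1)) + sum αs + sum βs))
      ≡⟨ solve 8 (λ x e y f j p σα σβ → x :+ e :+ (con 1 :+ y :+ (f :+ (j :+ p) :+ σα :+ σβ))
                                       := e :+ (con 1 :+ j :+ (f :+ p)) :+ (x :+ σα) :+ (y :+ σβ))
                 refl x e y (aFloor j) j (j ∸ 1) (sum αs) (sum βs) ⟩
    e + (suc j + (aFloor j + (j ∸ 1))) + (x + sum αs) + (y + sum βs)
      ≡⟨ cong (λ n → e + (suc j + n) + (x + sum αs) + (y + sum βs)) (aFloor+pred j) ⟩
    e + (suc j + j) + (x + sum αs) + (y + sum βs) ∎
    where open ≡-Reasoning

  length-parts : ∀ {m t} → Valid m t → length (parts t) ≡ m
  length-parts {t = profile s α β} (valid α-length β-length _ count) = trans (length-partsFromA s 0 α β α-length β-length) count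

  data Shape : Profile → Set where
    flat : ∀ n → Shape (profile 0 (n ∷ []) [])
    aTop : ∀ s x αs β → Shape (profile (suc s) (suc x ∷ αs) β)
    bTop : ∀ s αs y βs → Shape (profile (suc s) (zero ∷ αs) (y ∷ βs))

  shape : ∀ {m t} → Valid m t → Shape t
  shape {t = profile zero    (n ∷ [])     []}       _ = flat n
  shape {t = profile (suc s) (suc x ∷ αs) β}        _ = aTop s x αs β
  shape {t = profile (suc s) (zero ∷ αs)  (y ∷ βs)} _ = bTop s αs y βs
  shape {t = profile zero    []           _}        (valid () _ _ _)
  shape {t = profile zero    (_ ∷ _ ∷ _)  _}        (valid () _ _ _)
  shape {t = profile zero    (_ ∷ [])     (_ ∷ _)}  (valid _ () _ _)
  shape {t = profile (suc s) []           _}        (valid () _ _ _)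
  shape {t = profile (suc s) (zero ∷ αs)  []}       (valid _ () _ _)

  shape-unique : ∀ {t} (sh sh′ : Shape t) → sh ≡ sh′
  shape-unique (flat n)        (flat n)        = refl
  shape-unique (aTop s x αs β) (aTop s x αs β) = refl
  shape-unique (bTop s αs y βs) (bTop s αs y βs) = refl

  module _ {t : Profile} where

    largestPart nextLevel topMult : Shape t → ℕ
    largestPart (flat n)         = a
    largestPart (aTop s x αs β)  = aLevel (suc s)
    largestPart (bTop s αs y βs) = bLevel s

    nextLevel (flat n)         = b
    nextLevel (aTop s x αs β)  = bLevel (suc s)
    nextLevel (bTop s αs y βs) = aLevel (suc s)

    topMult (flat n)         = n
    topMult (aTop s x αs β)  = suc x
    topMult (bTop s αs y βs) = suc y

    belowTop : Shape t → List ℕ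
    belowTop (flat n)         = []
    belowTop (aTop s x αs β)  = partsFromB (suc s) αs β
    belowTop (bTop s αs y βs) = partsFromA s (aFloor s) αs βs

    -- condition (4) allows at most r copies of a b-level
    CanRepeat : Shape t → Set
    CanRepeat (bTop s αs y βs) = suc y < r
    CanRepeat _                = ⊤

    repeatLargest climb : Shape t → Profile
    repeatLargest (flat n)         = profile 0 (suc n ∷ []) []
    repeatLargest (aTop s x αs β)  = profile (suc s) (suc (suc x) ∷ αs) β
    repeatLargest (bTop s αs y βs) = profile (suc s) (zero ∷ αs) (suc y ∷ βs)

    climb (flat n)         = profile 1 (zero ∷ n ∷ []) (zero ∷ [])
    climb (aTop s x αs β)  = profile (suc (suc s)) (zero ∷ x ∷ αs) (zero ∷ β)
    climb (bTop s αs y βs) = profile (suc s) (1 ∷ αs) (y ∷ βs)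

    parts-repeatLargest : (sh : Shape t) → parts (repeatLargest sh) ≡ largestPart sh ∷ parts t
    parts-repeatLargest (flat n)         = refl
    parts-repeatLargest (aTop s x αs β)  = refl
    parts-repeatLargest (bTop s αs y βs) = refl

    parts-climb : (sh : Shape t) → parts (climb sh) ≡ nextLevel sh ∷ parts t
    parts-climb (flat n)         = refl
    parts-climb (aTop s x αs β)  = cong (λ n → bLevel (suc s) ∷ (replicate n (aLevel (suc s)) ++ partsFromB (suc s) αs β))
                                        (trans (+-comm x 1) (cong suc (sym (+-identityʳ x))))
    parts-climb (bTop s αs y βs) = refl

    largestPart<nextLevel : (sh : Shape t) → largestPart sh < nextLevel sh
    largestPart<nextLevel (flat n)         = a<b
    largestPart<nextLevel (aTop s x αs β)  = aLevel<bLevel (suc s)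
    largestPart<nextLevel (bTop s αs y βs) = bLevel<aLevel s

    parts-split : (sh : Shape t) → parts t ≡ replicate (topMult sh) (largestPart sh) ++ belowTop sh
    parts-split (flat n)         = cong (λ n → replicate n a ++ []) (+-identityʳ n)
    parts-split (aTop s x αs β)  = cong (λ n → replicate n (aLevel (suc s)) ++ partsFromB (suc s) αs β) (+-identityʳ (suc x))
    parts-split (bTop s αs y βs) = refl

  mutual
    partsFromA-≤ : ∀ j e α β → All (_≤ aLevel j) (partsFromA j e α β)
    partsFromA-≤ j e []       β = []
    partsFromA-≤ j e (x ∷ αs) β = All.++⁺ (All.replicate⁺ (x + e) ≤-refl) (All.map <⇒≤ (partsFromB-< j αs β))

    partsFromB-< : ∀ j α β → All (_< aLevel j) (partsFromB j α β)
    partsFromB-< zero    α β        = []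
    partsFromB-< (suc j) α []       = []
    partsFromB-< (suc j) α (y ∷ βs) =
      All.++⁺ (All.replicate⁺ (suc y) (bLevel<aLevel j))
              (All.map (λ x≤aⱼ → ≤-<-trans x≤aⱼ (aLevel<aLevel j)) (partsFromA-≤ j (aFloor j) α βs))

  belowTop-< : ∀ {t} (sh : Shape t) → All (_< largestPart sh) (belowTop sh)
  belowTop-< (flat n)         = []
  belowTop-< (aTop s x αs β)  = partsFromB-< (suc s) αs β
  belowTop-< (bTop s αs y βs) = All.map (λ x≤aₛ → ≤-<-trans x≤aₛ (aLevel<bLevel s)) (partsFromA-≤ s (aFloor s) αs βs)

  topMult-positive : ∀ {m t} → Valid (suc m) t → (sh : Shape t) → 1 ≤ topMult sh
  topMult-positive (valid _ _ _ count) (flat n) =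
    subst (1 ≤_) (trans (sym count) (trans (+-identityʳ _) (+-identityʳ n))) (s≤s z≤n)
  topMult-positive _ (aTop s x αs β)  = s≤s z≤n
  topMult-positive _ (bTop s αs y βs) = s≤s z≤n

  private
    partCount-incA : ∀ s x αs β → partCount (profile s (suc x ∷ αs) β) ≡ suc (partCount (profile s (x ∷ αs) β))
    partCount-incA s x αs β =
      solve 5 (λ s p x σα σβ → s :+ p :+ (con 1 :+ x :+ σα) :+ σβ := con 1 :+ (s :+ p :+ (x :+ σα) :+ σβ))
              refl s (s ∸ 1) x (sum αs) (sum β)

    partCount-incB : ∀ s α y βs → partCount (profile s α (suc y ∷ βs)) ≡ suc (partCount (profile s α (y ∷ βs)))
    partCount-incB s α y βs =
      solve 5 (λ s p σα y σβ → s :+ p :+ σα :+ (con 1 :+ y :+ σβ) := con 1 :+ (s :+ p :+ σα :+ (y :+ σβ)))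
              refl s (s ∸ 1) (sum α) y (sum βs)

    partCount-climbA : ∀ s x αs β →
      partCount (profile (suc (suc s)) (zero ∷ x ∷ αs) (zero ∷ β)) ≡ suc (partCount (profile (suc s) (suc x ∷ αs) β))
    partCount-climbA s x αs β =
      solve 4 (λ s x σα σβ → con 2 :+ s :+ (con 1 :+ s) :+ (x :+ σα) :+ σβ := con 1 :+ (con 1 :+ s :+ s :+ (con 1 :+ x :+ σα) :+ σβ))
              refl s x (sum αs) (sum β)

  repeatLargest-valid : ∀ {m t} → Valid m t → (sh : Shape t) → CanRepeat sh → Valid (suc m) (repeatLargest sh)
  repeatLargest-valid (valid α-length β-length bounded count) (flat n) _ =
    valid α-length β-length bounded (cong suc count)
  repeatLargest-valid (valid α-length β-length bounded count) (aTop s x αs β) _ =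
    valid α-length β-length bounded (trans (partCount-incA (suc s) (suc x) αs β) (cong suc count))
  repeatLargest-valid (valid α-length β-length (_ ∷ bounded) count) (bTop s αs y βs) 1+y<r =
    valid α-length β-length (1+y<r ∷ bounded) (trans (partCount-incB (suc s) (zero ∷ αs) y βs) (cong suc count))

  climb-valid : ∀ {m t} → Valid m t → (sh : Shape t) → Valid (suc m) (climb sh)
  climb-valid (valid α-length β-length bounded count) (flat n) =
    valid refl refl (1≤r ∷ []) (cong suc count)
  climb-valid (valid α-length β-length bounded count) (aTop s x αs β) =
    valid (cong suc α-length) (cong suc β-length) (1≤r ∷ bounded) (trans (partCount-climbA s x αs β) (cong suc count))
  climb-valid (valid α-length β-length bounded count) (bTop s αs y βs) =
    valid α-length β-length bounded (trans (partCount-incA (suc s) zero αs (y ∷ βs)) (cong suc count))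

  Step : ∀ {t′} → Shape t′ → Profile → Set
  Step sh t = t ≡ repeatLargest sh × CanRepeat sh ⊎ t ≡ climb sh

  Predecessor : ℕ → Profile → Set
  Predecessor m t = ∃₂ λ t′ (sh : Shape t′) → Valid m t′ × Step sh t

  predecessor : ∀ {m t} → Valid (suc m) t → Predecessor m t
  predecessor v = go (shape v) v
    where
    go : ∀ {m t} → Shape t → Valid (suc m) t → Predecessor m t
    go (flat zero)    (valid _ _ _ ())
    go (flat (suc n)) (valid _ _ _ count) =
      _ , flat n , valid refl refl [] (suc-injective count) , inj₁ (refl , tt)
    go (aTop s (suc x) αs β) (valid α-length β-length bounded count) =
      _ , aTop s x αs β , valid α-length β-length bounded (suc-injective (trans (sym (partCount-incA (suc s) (suc x) αs β)) count)) ,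
      inj₁ (refl , tt)
    go (aTop s zero αs (y ∷ βs)) (valid α-length β-length bounded count) =
      _ , bTop s αs y βs , valid α-length β-length bounded (suc-injective (trans (sym (partCount-incA (suc s) zero αs (y ∷ βs))) count)) ,
      inj₂ refl
    go (aTop s zero αs []) (valid _ () _ _)
    go (bTop s αs (suc y) βs) (valid α-length β-length (1+y<r ∷ bounded) count) =
      _ , bTop s αs y βs ,
      valid α-length β-length (<-trans (n<1+n y) 1+y<r ∷ bounded)
            (suc-injective (trans (sym (partCount-incB (suc s) (zero ∷ αs) y βs)) count)) ,
      inj₁ (refl , 1+y<r)
    go (bTop zero (n ∷ []) zero []) (valid _ _ _ count) =
      _ , flat n , valid refl refl [] (suc-injective count) , inj₂ refl
    go (bTop zero [] zero βs)            (valid () _ _ _)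
    go (bTop zero (_ ∷ _ ∷ _) zero βs)   (valid () _ _ _)
    go (bTop zero (_ ∷ []) zero (_ ∷ _)) (valid _ () _ _)
    go (bTop (suc s) [] zero βs)         (valid () _ _ _)
    go (bTop (suc s) (x ∷ αs) zero βs) (valid α-length β-length (_ ∷ bounded) count) =
      _ , aTop s x αs βs ,
      valid (suc-injective α-length) (suc-injective β-length) bounded (suc-injective (trans (sym (partCount-climbA s x αs βs)) count)) ,
      inj₂ refl

  valid-zero : ∀ {t} → Valid 0 t → t ≡ profile 0 (0 ∷ []) []
  valid-zero v = go (shape v) v
    where
    go : ∀ {t} → Shape t → Valid 0 t → t ≡ profile 0 (0 ∷ []) []
    go (flat n) (valid _ _ _ count) = cong (λ n → profile 0 (n ∷ []) []) (m+n≡0⇒m≡0 n (m+n≡0⇒m≡0 (n + 0) count))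
    go (aTop s x αs β)  (valid _ _ _ ())
    go (bTop s αs y βs) (valid _ _ _ ())

  private
    at-replicate-++ : ∀ n (v : ℕ) xs {i} → i < n → at (replicate n v ++ xs) i ≡ v
    at-replicate-++ (suc n) v xs {zero}  _         = refl
    at-replicate-++ (suc n) v xs {suc i} (s≤s i<n) = at-replicate-++ n v xs i<n

    at-replicate-++-end : ∀ n (v : ℕ) xs → at (replicate n v ++ xs) n ≡ at xs 0
    at-replicate-++-end zero    v xs = refl
    at-replicate-++-end (suc n) v xs = at-replicate-++-end n v xs

    at-0-< : ∀ {v xs} → All (_< v) xs → 1 ≤ length xs → at xs 0 < v
    at-0-< (x<v ∷ _) _ = x<v

  Extension : ∀ {t} → Shape t → ℕ → Set
  Extension sh x = x ≡ largestPart sh × CanRepeat sh ⊎ x ≡ nextLevel sh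

  data TopKind {t} (sh : Shape t) : Set where
    aKind : ∀ j → largestPart sh ≡ aLevel j → nextLevel sh ≡ bLevel j → CanRepeat sh → TopKind sh
    bKind : ∀ j → largestPart sh ≡ bLevel j → nextLevel sh ≡ aLevel (suc j) →
            (CanRepeat sh → topMult sh < r) → (topMult sh < r → CanRepeat sh) → TopKind sh

  topKind : ∀ {t} (sh : Shape t) → TopKind sh
  topKind (flat n)         = aKind 0 refl refl tt
  topKind (aTop s x αs β)  = aKind (suc s) refl refl tt
  topKind (bTop s αs y βs) = bKind s refl refl (λ 1+y<r → 1+y<r) (λ 1+y<r → 1+y<r)

  module _ {m : ℕ} {t : Profile} (v : Valid (suc m) t) (sh : Shape t) where

    private
      top-run : ∀ {i} → i < topMult sh → at (parts t) i ≡ largestPart sh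
      top-run i<n = trans (cong (λ π → at π _) (parts-split sh)) (at-replicate-++ (topMult sh) _ _ i<n)

      first : at (parts t) 0 ≡ largestPart sh
      first = top-run (topMult-positive v sh)

      length-split : topMult sh + length (belowTop sh) ≡ suc m
      length-split = trans (sym (length-replicate-++ (topMult sh) (largestPart sh) (belowTop sh)))
                           (trans (cong length (sym (parts-split sh))) (length-parts v))

      run-leaves-top : topMult sh < r → r < suc (suc m) → at (parts t) (topMult sh) < largestPart sh
      run-leaves-top n<r r≤1+m = subst (_< largestPart sh) (sym after-top)
        (at-0-< (belowTop-< sh) (+-cancelˡ-< (topMult sh) 0 (length (belowTop sh))
          (subst (topMult sh + 0 <_) (sym length-split)
            (subst (_< suc m) (sym (+-identityʳ (topMult sh))) (<-≤-trans n<r (≤-pred r≤1+m))))))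
        where
        after-top : at (parts t) (topMult sh) ≡ at (belowTop sh) 0
        after-top = trans (cong (λ π → at π (topMult sh)) (parts-split sh)) (at-replicate-++-end (topMult sh) _ _)

      above-top : ∀ {x y} → CanPrepend (suc m) x (parts t) → largestPart sh ≡ y → y ≤ x
      above-top {x} cp top≡y = subst (_≤ x) (trans first top≡y) (CanPrepend.above cp)

      gap-top : ∀ {x y} → CanPrepend (suc m) x (parts t) → largestPart sh ≡ y → x ∸ y < k
      gap-top {x} cp top≡y = subst (λ y → x ∸ y < k) (trans first top≡y) (CanPrepend.gap cp)

    canPrepend⇒extension : ∀ {x} → CanPrepend (suc m) x (parts t) → Extension sh x
    canPrepend⇒extension {x} cp with topKind sh
    ... | aKind j top≡aⱼ next≡bⱼ ok with aLevel-successor j (above-top cp top≡aⱼ) (gap-top cp top≡aⱼ) (CanPrepend.residue cp)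
    ...   | inj₁ x≡aⱼ = inj₁ (trans x≡aⱼ (sym top≡aⱼ) , ok)
    ...   | inj₂ x≡bⱼ = inj₂ (trans x≡bⱼ (sym next≡bⱼ))
    canPrepend⇒extension {x} cp | bKind j top≡bⱼ next≡aⱼ₊₁ _ ok
      with bLevel-successor j (above-top cp top≡bⱼ) (gap-top cp top≡bⱼ) (CanPrepend.residue cp)
    ...   | inj₂ x≡aⱼ₊₁ = inj₂ (trans x≡aⱼ₊₁ (sym next≡aⱼ₊₁))
    ...   | inj₁ x≡bⱼ with topMult sh <? r
    ...     | yes n<r = inj₁ (trans x≡bⱼ (sym top≡bⱼ) , ok n<r)
    ...     | no n≮r  = ⊥-elim (a≢b-mod-k (trans (sym x≡a) (trans (cong (_% k) x≡bⱼ) (bLevel-residue j))))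
      where
      -- a top block of r or more copies of a b-level would force x ≡ a (mod k)
      r≤n : r ≤ topMult sh
      r≤n = ≮⇒≥ n≮r
      x≡a : x % k ≡ a % k
      x≡a = CanPrepend.run cp (s≤s (≤-trans r≤n (subst (topMult sh ≤_) length-split (m≤m+n _ _))))
                              (λ i i<r → trans (top-run (<-≤-trans i<r r≤n)) (sym first))
                              (trans (cong (_% k) (trans first top≡bⱼ)) (bLevel-residue j))

    private
      a-top-not-b : ∀ {j} → largestPart sh ≡ aLevel j → at (parts t) 0 % k ≢ b % k
      a-top-not-b {j} top≡aⱼ first≡b =
        a≢b-mod-k (trans (sym (aLevel-residue j)) (trans (cong (_% k) (sym (trans first top≡aⱼ))) first≡b))

      gap-repeat : largestPart sh ∸ at (parts t) 0 < k
      gap-repeat = subst (λ y → largestPart sh ∸ y < k) (sym first) (subst (_< k) (sym (n∸n≡0 (largestPart sh))) 0<k)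

    extension⇒canPrepend : ∀ {x} → Extension sh x → CanPrepend (suc m) x (parts t)
    extension⇒canPrepend ext with topKind sh
    extension⇒canPrepend (inj₁ (refl , _)) | aKind j top≡aⱼ _ _ = record
      { above   = ≤-reflexive first
      ; residue = inj₁ (trans (cong (_% k) top≡aⱼ) (aLevel-residue j))
      ; gap     = gap-repeat
      ; run     = λ _ _ first≡b → ⊥-elim (a-top-not-b {j} top≡aⱼ first≡b)
      }
    extension⇒canPrepend (inj₂ refl) | aKind j top≡aⱼ next≡bⱼ _ = record
      { above   = subst₂ _≤_ (sym (trans first top≡aⱼ)) (sym next≡bⱼ) (<⇒≤ (aLevel<bLevel j))
      ; residue = inj₂ (trans (cong (_% k) next≡bⱼ) (bLevel-residue j))
      ; gap     = subst₂ (λ u w → u ∸ w < k) (sym next≡bⱼ) (sym (trans first top≡aⱼ)) (aLevel→bLevel-gap j)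
      ; run     = λ _ _ first≡b → ⊥-elim (a-top-not-b {j} top≡aⱼ first≡b)
      }
    extension⇒canPrepend (inj₁ (refl , ok)) | bKind j top≡bⱼ _ n<r _ = record
      { above   = ≤-reflexive first
      ; residue = inj₂ (trans (cong (_% k) top≡bⱼ) (bLevel-residue j))
      ; gap     = gap-repeat
      ; run     = λ r<2+m same _ → ⊥-elim (<-irrefl (trans (same (topMult sh) (n<r ok)) first) (run-leaves-top (n<r ok) r<2+m))
      }
    extension⇒canPrepend (inj₂ refl) | bKind j top≡bⱼ next≡aⱼ₊₁ _ _ = record
      { above   = subst₂ _≤_ (sym (trans first top≡bⱼ)) (sym next≡aⱼ₊₁) (<⇒≤ (bLevel<aLevel j))
      ; residue = inj₁ (trans (cong (_% k) next≡aⱼ₊₁) (aLevel-residue (suc j)))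
      ; gap     = subst₂ (λ u w → u ∸ w < k) (sym next≡aⱼ₊₁) (sym (trans first top≡bⱼ)) (bLevel→aLevel-gap j)
      ; run     = λ _ _ _ → trans (cong (_% k) next≡aⱼ₊₁) (aLevel-residue (suc j))
      }

  BP⇒profile : ∀ {m π} → InBP (suc m) π → ∃ λ t → Valid (suc m) t × π ≡ parts t
  BP⇒profile {zero} bp with BP-one⁻ bp
  ... | inj₁ refl = profile 0 (1 ∷ []) [] , valid refl refl [] refl , refl
  ... | inj₂ refl = profile 1 (0 ∷ 0 ∷ []) (0 ∷ []) , valid refl refl (1≤r ∷ []) refl , refl
  BP⇒profile {suc m} {[]}    bp with () ← BP.len bp
  BP⇒profile {suc m} {x ∷ π} bp with BP-uncons bp
  ... | bp′ , cp with BP⇒profile bp′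
  ... | t , v , refl with canPrepend⇒extension v (shape v) cp
  ... | inj₁ (refl , ok) = repeatLargest (shape v) , repeatLargest-valid v (shape v) ok , sym (parts-repeatLargest (shape v))
  ... | inj₂ refl        = climb (shape v) , climb-valid v (shape v) , sym (parts-climb (shape v))

  private
    added : ∀ {t t′} (sh : Shape t′) → Step sh t → ℕ
    added sh (inj₁ _) = largestPart sh
    added sh (inj₂ _) = nextLevel sh

    parts-step : ∀ {t t′} (sh : Shape t′) step → parts t ≡ added {t} sh step ∷ parts t′
    parts-step sh (inj₁ (refl , _)) = parts-repeatLargest sh
    parts-step sh (inj₂ refl)       = parts-climb sh

    Extension-step : ∀ {t t′} {sh : Shape t′} step → Extension sh (added {t} sh step)
    Extension-step (inj₁ (_ , ok)) = inj₁ (refl , ok)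
    Extension-step (inj₂ _)        = inj₂ refl

  profile⇒BP : ∀ {m t} → Valid (suc m) t → InBP (suc m) (parts t)
  profile⇒BP {zero} v with predecessor v
  ... | t′ , sh , v′ , step with valid-zero v′
  ... | refl with sh | step
  ...   | flat 0 | inj₁ (refl , _) = BP-one⁺ (inj₁ refl)
  ...   | flat 0 | inj₂ refl       = BP-one⁺ (inj₂ refl)
  profile⇒BP {suc m} v with predecessor v
  ... | t′ , sh , v′ , step =
    subst (InBP (suc (suc m))) (sym (parts-step sh step)) (BP-cons (profile⇒BP v′) (extension⇒canPrepend v′ sh (Extension-step step)))

  parts-injective : ∀ {m t u} → Valid m t → Valid m u → parts t ≡ parts u → t ≡ u
  parts-injective {zero}  vt vu _  = trans (valid-zero vt) (sym (valid-zero vu))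
  parts-injective {suc m} vt vu eq with predecessor vt | predecessor vu
  ... | t′ , sh , vt′ , step | u′ , sh′ , vu′ , step′
    with parts-injective vt′ vu′ (∷-injectiveʳ eq′) | ∷-injectiveˡ eq′
    where eq′ = trans (sym (parts-step sh step)) (trans eq (parts-step sh′ step′))
  ... | refl | same-added with shape-unique sh sh′
  ... | refl = same-step step step′ same-added
    where
    same-step : ∀ {t u} step step′ → added {t} sh′ step ≡ added {u} sh′ step′ → t ≡ u
    same-step (inj₁ (refl , _)) (inj₁ (refl , _)) _ = refl
    same-step (inj₂ refl)       (inj₂ refl)       _ = refl
    same-step (inj₁ (refl , _)) (inj₂ refl)       e = ⊥-elim (<⇒≢ (largestPart<nextLevel sh′) e)
    same-step (inj₂ refl)       (inj₁ (refl , _)) e = ⊥-elim (<⇒≢ (largestPart<nextLevel sh′) (sym e))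

  aMultLists : ℕ → ℕ → List (List ℕ)
  aMultLists zero    N = (N ∷ []) ∷ []
  aMultLists (suc s) N = concatRange (suc N) (λ y → map ((N ∸ y) ∷_) (aMultLists s y))

  bMultLists : ℕ → ℕ → List (List ℕ)
  bMultLists zero    zero    = [] ∷ []
  bMultLists zero    (suc h) = []
  bMultLists (suc s) h       = concatRange r (λ x → map (x ∷_) (atDiff [] (bMultLists s) h x))

  private
    ∈-map-∷⁻ : ∀ (x : ℕ) {xss : List (List ℕ)} {ys} → ys ∈ map (x ∷_) xss → ∃ λ zs → ys ≡ x ∷ zs × zs ∈ xss
    ∈-map-∷⁻ x ys∈ with ∈-map⁻ (x ∷_) ys∈
    ... | zs , zs∈ , refl = zs , refl , zs∈

    map-∷-unique : ∀ (x : ℕ) {xss : List (List ℕ)} → Unique xss → Unique (map (x ∷_) xss)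
    map-∷-unique x = Unique.map⁺ ∷-injectiveʳ

    head : List ℕ → ℕ
    head []      = 0
    head (x ∷ _) = x

  ∈-aMultLists⁻ : ∀ s N {α} → α ∈ aMultLists s N → length α ≡ suc s × sum α ≡ N
  ∈-aMultLists⁻ zero    N (here refl) = refl , +-identityʳ N
  ∈-aMultLists⁻ (suc s) N α∈ with ∈-concatRange⁻ _ (suc N) α∈
  ... | y , s≤s y≤N , α∈y with ∈-map-∷⁻ (N ∸ y) α∈y
  ... | α′ , refl , α′∈ with ∈-aMultLists⁻ s y α′∈
  ... | α′-length , α′-sum = cong suc α′-length , trans (cong (N ∸ y +_) α′-sum) (m∸n+n≡m y≤N)

  ∈-aMultLists⁺ : ∀ s N {α} → length α ≡ suc s → sum α ≡ N → α ∈ aMultLists s N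
  ∈-aMultLists⁺ zero    N {x ∷ []}     _ α-sum = here (cong (_∷ []) (trans (sym (+-identityʳ x)) α-sum))
  ∈-aMultLists⁺ (suc s) N {x ∷ α′} α-length α-sum =
    ∈-concatRange⁺ _ (suc N) (sum α′) (s≤s σ≤N)
      (subst (λ z → z ∷ α′ ∈ map ((N ∸ sum α′) ∷_) (aMultLists s (sum α′))) N∸σ≡x
        (∈-map⁺ ((N ∸ sum α′) ∷_) (∈-aMultLists⁺ s (sum α′) (suc-injective α-length) refl)))
    where
    σ≤N : sum α′ ≤ N
    σ≤N = subst (sum α′ ≤_) α-sum (m≤n+m (sum α′) x)
    N∸σ≡x : N ∸ sum α′ ≡ x
    N∸σ≡x = trans (cong (_∸ sum α′) (sym α-sum)) (m+n∸n≡m x (sum α′))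

  ∈-bMultLists⁻ : ∀ s h {β} → β ∈ bMultLists s h → length β ≡ s × All (_< r) β × sum β ≡ h
  ∈-bMultLists⁻ zero    zero (here refl) = refl , [] , refl
  ∈-bMultLists⁻ (suc s) h  β∈ with ∈-concatRange⁻ _ r β∈
  ... | x , x<r , β∈x with ∈-map-∷⁻ x β∈x
  ... | β′ , refl , β′∈ with ∈-atDiff⁻ (bMultLists s) h x β′∈
  ... | x≤h , β′∈′ with ∈-bMultLists⁻ s (h ∸ x) β′∈′
  ... | β′-length , β′-bounded , β′-sum = cong suc β′-length , x<r ∷ β′-bounded , trans (cong (x +_) β′-sum) (m+[n∸m]≡n x≤h)

  ∈-bMultLists⁺ : ∀ s h {β} → length β ≡ s → All (_< r) β → sum β ≡ h → β ∈ bMultLists s h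
  ∈-bMultLists⁺ zero    zero    {[]} _ _ _ = here refl
  ∈-bMultLists⁺ (suc s) h {x ∷ β′} β-length (x<r ∷ β′-bounded) β-sum =
    ∈-concatRange⁺ _ r x x<r (∈-map⁺ (x ∷_) (∈-atDiff⁺ (bMultLists s) x≤h
      (∈-bMultLists⁺ s (h ∸ x) (suc-injective β-length) β′-bounded (trans (sym (m+n∸m≡n x (sum β′))) (cong (_∸ x) β-sum)))))
    where
    x≤h : x ≤ h
    x≤h = subst (x ≤_) β-sum (m≤m+n x (sum β′))

  aMultLists-unique : ∀ s N → Unique (aMultLists s N)
  aMultLists-unique zero    N = [] ∷ []
  aMultLists-unique (suc s) N = concatRange-unique _ (suc N) (λ y _ → map-∷-unique (N ∸ y) (aMultLists-unique s y)) disjoint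
    where
    disjoint : ∀ i j {z} → i < suc N → j < suc N →
               z ∈ map ((N ∸ i) ∷_) (aMultLists s i) → z ∈ map ((N ∸ j) ∷_) (aMultLists s j) → i ≡ j
    disjoint i j (s≤s i≤N) (s≤s j≤N) z∈i z∈j with ∈-map-∷⁻ (N ∸ i) z∈i | ∈-map-∷⁻ (N ∸ j) z∈j
    ... | _ , refl , _ | _ , eq , _ = ∸-cancelˡ-≡ i≤N j≤N (cong head eq)

  bMultLists-unique : ∀ s h → Unique (bMultLists s h)
  bMultLists-unique zero    zero    = [] ∷ []
  bMultLists-unique zero    (suc h) = []
  bMultLists-unique (suc s) h       =
    concatRange-unique _ r (λ x _ → map-∷-unique x (atDiff-unique (bMultLists s) (bMultLists-unique s) h x)) disjoint
    where
    disjoint : ∀ i j {z} → i < r → j < r →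
               z ∈ map (i ∷_) (atDiff [] (bMultLists s) h i) → z ∈ map (j ∷_) (atDiff [] (bMultLists s) h j) → i ≡ j
    disjoint i j _ _ z∈i z∈j with ∈-map-∷⁻ i z∈i | ∈-map-∷⁻ j z∈j
    ... | _ , refl , _ | _ , eq , _ = cong head eq

  toProfile : ℕ → List ℕ × List ℕ → Profile
  toProfile s (α , β) = profile s α β

  -- a profile of height s ≥ 1 with ∑ β = h and m parts has ∑ α = m + 1 ∸ (h + 2 s)
  profilesWith : ℕ → ℕ → ℕ → List Profile
  profilesWith m s h = atDiff [] (λ N → map (toProfile s) (cartesianProduct (aMultLists s N) (bMultLists s h))) (suc m) (h + s + s)

  profiles : ℕ → List Profile
  profiles m = profile 0 (m ∷ []) [] ∷ concatRange m (λ s′ → concatRange (suc m) (profilesWith m (suc s′)))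

  private
    ∈-profilesWith⁻ : ∀ m s h {t} → t ∈ profilesWith m s h →
      ∃₂ λ α β → t ≡ profile s α β × h + s + s ≤ suc m × α ∈ aMultLists s (suc m ∸ (h + s + s)) × β ∈ bMultLists s h
    ∈-profilesWith⁻ m s h t∈ with ∈-atDiff⁻ _ (suc m) (h + s + s) t∈
    ... | hss≤1+m , t∈′ with ∈-map⁻ (toProfile s) t∈′
    ... | (α , β) , αβ∈ , refl with ∈-cartesianProduct⁻ (aMultLists s _) (bMultLists s h) αβ∈
    ... | α∈ , β∈ = α , β , refl , hss≤1+m , α∈ , β∈

    ∈-profiles-tail⁻ : ∀ m {t} → t ∈ concatRange m (λ s′ → concatRange (suc m) (profilesWith m (suc s′))) →
      ∃₂ λ s′ h → ∃₂ λ α β → t ≡ profile (suc s′) α β × h + suc s′ + suc s′ ≤ suc m ×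
                              α ∈ aMultLists (suc s′) (suc m ∸ (h + suc s′ + suc s′)) × β ∈ bMultLists (suc s′) h
    ∈-profiles-tail⁻ m t∈ with ∈-concatRange⁻ _ m t∈
    ... | s′ , _ , t∈s′ with ∈-concatRange⁻ _ (suc m) t∈s′
    ... | h , _ , t∈h = s′ , h , ∈-profilesWith⁻ m (suc s′) h t∈h

  ∈-profiles⁻ : ∀ m {t} → t ∈ profiles m → Valid m t
  ∈-profiles⁻ m (here refl) = valid refl refl [] (trans (+-identityʳ _) (+-identityʳ m))
  ∈-profiles⁻ m (there t∈) with ∈-profiles-tail⁻ m t∈
  ... | s′ , h , α , β , refl , D≤1+m , α∈ , β∈ with ∈-aMultLists⁻ (suc s′) _ α∈ | ∈-bMultLists⁻ (suc s′) h β∈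
  ... | α-length , α-sum | β-length , β-bounded , β-sum =
    valid α-length β-length β-bounded (trans (cong₂ (λ σα σβ → suc s′ + s′ + σα + σβ) α-sum β-sum) count)
    where
    D = h + suc s′ + suc s′
    count : suc s′ + s′ + (suc m ∸ D) + h ≡ m
    count = suc-injective (trans (solve 3 (λ s n h → con 1 :+ (con 1 :+ s :+ s :+ n :+ h) := n :+ (h :+ (con 1 :+ s) :+ (con 1 :+ s)))
                                          refl s′ (suc m ∸ D) h)
                                 (m∸n+n≡m D≤1+m))

  ∈-profiles⁺ : ∀ m {t} → Valid m t → t ∈ profiles m
  ∈-profiles⁺ m {profile zero (n ∷ []) []} (valid _ _ _ count) =
    here (cong (λ n → profile 0 (n ∷ []) []) (trans (sym (trans (+-identityʳ _) (+-identityʳ n))) count))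
  ∈-profiles⁺ m {profile zero    []          _}       (valid () _ _ _)
  ∈-profiles⁺ m {profile zero    (_ ∷ _ ∷ _) _}       (valid () _ _ _)
  ∈-profiles⁺ m {profile zero    (_ ∷ [])    (_ ∷ _)} (valid _ () _ _)
  ∈-profiles⁺ m {profile (suc s′) α β} (valid α-length β-length β-bounded count) =
    there (∈-concatRange⁺ _ m s′ s′<m (∈-concatRange⁺ _ (suc m) h h<1+m
      (∈-atDiff⁺ _ D≤1+m (∈-map⁺ (toProfile (suc s′)) (∈-cartesianProduct⁺
        (∈-aMultLists⁺ (suc s′) _ α-length α-sum) (∈-bMultLists⁺ (suc s′) h β-length β-bounded refl))))))
    where
    h = sum β
    D = h + suc s′ + suc s′
    σα+D≡1+m : sum α + D ≡ suc m
    σα+D≡1+m = trans (solve 3 (λ s σα h → σα :+ (h :+ (con 1 :+ s) :+ (con 1 :+ s)) := con 1 :+ (con 1 :+ s :+ s :+ σα :+ h))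
                              refl s′ (sum α) h)
                     (cong suc count)
    s′<m : s′ < m
    s′<m = subst (s′ <_) count (≤-trans (m≤m+n (suc s′) s′) (≤-trans (m≤m+n _ (sum α)) (m≤m+n _ h)))
    h<1+m : h < suc m
    h<1+m = s≤s (subst (h ≤_) count (m≤n+m h _))
    D≤1+m : D ≤ suc m
    D≤1+m = subst (D ≤_) σα+D≡1+m (m≤n+m D (sum α))
    α-sum : sum α ≡ suc m ∸ D
    α-sum = trans (sym (m+n∸n≡m (sum α) D)) (cong (_∸ D) σα+D≡1+m)

  profiles-unique : ∀ m → Unique (profiles m)
  profiles-unique m = All.tabulate (λ t∈ t≡flat → flat∉tail (sym t≡flat) t∈) ∷ tail-unique
    where
    flat∉tail : ∀ {t} → t ≡ profile 0 (m ∷ []) [] → t ∉ concatRange m (λ s′ → concatRange (suc m) (profilesWith m (suc s′)))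
    flat∉tail t≡flat t∈ with ∈-profiles-tail⁻ m t∈
    ... | _ , _ , _ , _ , refl , _ with () ← t≡flat
    profilesWith-unique : ∀ s h → Unique (profilesWith m s h)
    profilesWith-unique s h =
      atDiff-unique _ (λ N → Unique.map⁺ (λ { refl → refl }) (Unique.cartesianProduct⁺ (aMultLists-unique s N) (bMultLists-unique s h)))
                    (suc m) (h + s + s)
    tail-unique : Unique (concatRange m (λ s′ → concatRange (suc m) (profilesWith m (suc s′))))
    tail-unique = concatRange-unique _ m (λ s′ _ → concatRange-unique _ (suc m) (λ h _ → profilesWith-unique (suc s′) h) same-h) same-s
      where
      same-h : ∀ {s′} i j {t} → i < suc m → j < suc m → t ∈ profilesWith m (suc s′) i → t ∈ profilesWith m (suc s′) j → i ≡ j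
      same-h {s′} i j _ _ t∈i t∈j with ∈-profilesWith⁻ m (suc s′) i t∈i | ∈-profilesWith⁻ m (suc s′) j t∈j
      ... | _ , _ , refl , _ , _ , β∈i | _ , _ , refl , _ , _ , β∈j =
        trans (sym (proj₂ (proj₂ (∈-bMultLists⁻ (suc s′) i β∈i)))) (proj₂ (proj₂ (∈-bMultLists⁻ (suc s′) j β∈j)))
      same-s : ∀ i j {t} → i < m → j < m →
               t ∈ concatRange (suc m) (profilesWith m (suc i)) → t ∈ concatRange (suc m) (profilesWith m (suc j)) → i ≡ j
      same-s i j _ _ t∈i t∈j with ∈-concatRange⁻ _ (suc m) t∈i | ∈-concatRange⁻ _ (suc m) t∈j
      ... | hᵢ , _ , t∈hᵢ | hⱼ , _ , t∈hⱼ with ∈-profilesWith⁻ m (suc i) hᵢ t∈hᵢ | ∈-profilesWith⁻ m (suc j) hⱼ t∈hⱼ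
      ... | _ , _ , refl , _ | _ , _ , eq , _ = suc-injective (cong height eq)

  -- both sides count the parts a, a + k, … of a profile of height 1 + s′ with m parts and ∑ β = h
  a-part-count : ∀ m s′ h → h + suc s′ + suc s′ ≤ suc m → m ∸ h ∸ suc s′ ≡ suc m ∸ (h + suc s′ + suc s′) + s′
  a-part-count m s′ h D≤1+m = begin
    m ∸ h ∸ suc s′                 ≡⟨ ∸-+-assoc m h (suc s′) ⟩
    m ∸ (h + suc s′)               ≡⟨ cong (_∸ (h + suc s′)) total ⟨
    N + s′ + (h + suc s′) ∸ (h + suc s′) ≡⟨ m+n∸n≡m (N + s′) (h + suc s′) ⟩
    N + s′                         ∎
    where
    open ≡-Reasoning
    N = suc m ∸ (h + suc s′ + suc s′)
    total : N + s′ + (h + suc s′) ≡ m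
    total = suc-injective (trans (solve 3 (λ n h s → con 1 :+ (n :+ s :+ (h :+ (con 1 :+ s))) := n :+ (h :+ (con 1 :+ s) :+ (con 1 :+ s)))
                                          refl N h s′)
                                 (m∸n+n≡m D≤1+m))

  partitions : ℕ → List (List ℕ)
  partitions m = map parts (profiles m)

  ∈-partitions⇔BP : ∀ m {π} → π ∈ partitions (suc m) ⇔ InBP (suc m) π
  ∈-partitions⇔BP m = mk⇔ to from
    where
    to : ∀ {π} → π ∈ partitions (suc m) → InBP (suc m) π
    to π∈ with ∈-map⁻ parts π∈
    ... | t , t∈ , refl = profile⇒BP (∈-profiles⁻ (suc m) t∈)
    from : ∀ {π} → InBP (suc m) π → π ∈ partitions (suc m)
    from bp with BP⇒profile bp
    ... | t , v , refl = ∈-map⁺ parts (∈-profiles⁺ (suc m) v)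

  partitions-unique : ∀ m → Unique (partitions m)
  partitions-unique m =
    map-unique-on parts (λ t∈ u∈ → parts-injective (∈-profiles⁻ m t∈) (∈-profiles⁻ m u∈)) (profiles-unique m)

module Weights {c ℓ′} (R : CommutativeRing c ℓ′) (μ ν q : CommutativeRing.Carrier R)
               (a b k r : ℕ) .{{_ : NonZero k}} (1≤a : 1 ≤ a) (a<b : a < b) (b≤k : b ≤ k) (1≤r : 1 ≤ r) where

  open import Data.Nat using (_∸_; _≤?_; s≤s) renaming (_+_ to _+ℕ_; _*_ to _*ℕ_)
  import Data.Nat.Properties as ℕ
  open import Data.Nat.DivMod using (_%_)
  open import Data.Nat.ListAction using (sum)
  open import Data.List using ([]; _∷_; _++_; map; length; replicate; cartesianProduct)
  import Data.List.Properties as List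
  open import Data.List.Membership.Propositional.Properties using (∈-cartesianProduct⁻)
  open import Data.Integer as ℤ using (+_)
  open import Data.Product using (_,_; proj₁; proj₂)
  open import Relation.Nullary using (yes; no)
  open import Relation.Binary.PropositionalEquality as ≡ using (_≡_; _≢_)

  open CommutativeRing R
  open RingSums R
  open GaussianBinomials R
  open BoundedCompositions R
  open QBinomials R
  open Profiles a b k r 1≤a a<b b≤k 1≤r
  open Enumeration using (concatRange; atDiff; atDiff-≤; atDiff->)
  open import Algebra.Solver.Ring.NaturalCoefficients.Default commutativeSemiring using (solve; _:=_; _:*_; con)
  open import Relation.Binary.Reasoning.Setoid setoid

  wt : List ℕ → Carrier
  wt = weight R μ ν q a b k

  X Y Q : Carrier
  X = μ * q ^ a
  Y = ν * q ^ b
  Q = q ^ k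

  private
    ℓ-accept : ∀ d {x} π → x % k ≡ d % k → ℓ k d (x ∷ π) ≡ suc (ℓ k d π)
    ℓ-accept d π x≡d = ≡.cong length (List.filter-accept (λ z → z % k ℕ.≟ d % k) x≡d)

    ℓ-reject : ∀ d {x} π → x % k ≢ d % k → ℓ k d (x ∷ π) ≡ ℓ k d π
    ℓ-reject d π x≢d = ≡.cong length (List.filter-reject (λ z → z % k ℕ.≟ d % k) x≢d)

  weight-[] : wt [] ≈ 1#
  weight-[] = trans (*-identityʳ _) (*-identityʳ _)

  weight-∷-a : ∀ {x} π → x % k ≡ a % k → wt (x ∷ π) ≈ μ * q ^ x * wt π
  weight-∷-a {x} π x≡a = begin
    μ ^ ℓ k a (x ∷ π) * ν ^ ℓ k b (x ∷ π) * q ^ (x +ℕ sum π)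
      ≈⟨ *-cong (*-cong (^-congʳ μ (ℓ-accept a π x≡a))
                        (^-congʳ ν (ℓ-reject b π (λ x≡b → a≢b-mod-k (≡.trans (≡.sym x≡a) x≡b)))))
                (^-homo-* q x (sum π)) ⟩
    μ * μ ^ ℓ k a π * ν ^ ℓ k b π * (q ^ x * q ^ sum π)
      ≈⟨ solve 5 (λ m u v x s → m :* u :* v :* (x :* s) := m :* x :* (u :* v :* s)) refl μ _ _ _ _ ⟩
    μ * q ^ x * wt π ∎

  weight-∷-b : ∀ {x} π → x % k ≡ b % k → wt (x ∷ π) ≈ ν * q ^ x * wt π
  weight-∷-b {x} π x≡b = begin
    μ ^ ℓ k a (x ∷ π) * ν ^ ℓ k b (x ∷ π) * q ^ (x +ℕ sum π)
      ≈⟨ *-cong (*-cong (^-congʳ μ (ℓ-reject a π (λ x≡a → a≢b-mod-k (≡.trans (≡.sym x≡a) x≡b))))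
                        (^-congʳ ν (ℓ-accept b π x≡b)))
                (^-homo-* q x (sum π)) ⟩
    μ ^ ℓ k a π * (ν * ν ^ ℓ k b π) * (q ^ x * q ^ sum π)
      ≈⟨ solve 5 (λ n u v x s → u :* (n :* v) :* (x :* s) := n :* x :* (u :* v :* s)) refl ν _ _ _ _ ⟩
    ν * q ^ x * wt π ∎

  aWeight bWeight : ℕ → Carrier
  aWeight j = X * Q ^ j
  bWeight j = Y * Q ^ j

  private
    q^arithmetic : ∀ (f : ℕ → ℕ) → (∀ j → f (suc j) ≡ k +ℕ f j) → ∀ j → q ^ f j ≈ q ^ f 0 * Q ^ j
    q^arithmetic f step zero    = sym (*-identityʳ _)
    q^arithmetic f step (suc j) = begin
      q ^ f (suc j)            ≈⟨ ^-congʳ q (step j) ⟩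
      q ^ (k +ℕ f j)           ≈⟨ ^-homo-* q k (f j) ⟩
      Q * q ^ f j              ≈⟨ *-congˡ (q^arithmetic f step j) ⟩
      Q * (q ^ f 0 * Q ^ j)    ≈⟨ solve 3 (λ x y z → x :* (y :* z) := y :* (x :* z)) refl Q _ _ ⟩
      q ^ f 0 * Q ^ suc j      ∎

  weight-∷-aLevel : ∀ j π → wt (aLevel j ∷ π) ≈ aWeight j * wt π
  weight-∷-aLevel j π = trans (weight-∷-a π (aLevel-residue j))
                              (*-congʳ (trans (*-congˡ (q^arithmetic aLevel (λ _ → ≡.refl) j)) (sym (*-assoc _ _ _))))

  weight-∷-bLevel : ∀ j π → wt (bLevel j ∷ π) ≈ bWeight j * wt π
  weight-∷-bLevel j π = trans (weight-∷-b π (bLevel-residue j))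
                              (*-congʳ (trans (*-congˡ (q^arithmetic bLevel (λ _ → ≡.refl) j)) (sym (*-assoc _ _ _))))

  weight-replicate-++ : ∀ {v w} → (∀ π → wt (v ∷ π) ≈ w * wt π) → ∀ n π → wt (replicate n v ++ π) ≈ w ^ n * wt π
  weight-replicate-++ w-∷ zero    π = sym (*-identityˡ _)
  weight-replicate-++ w-∷ (suc n) π = trans (w-∷ _) (trans (*-congˡ (weight-replicate-++ w-∷ n π)) (sym (*-assoc _ _ _)))

  mutual
    aWeights : ℕ → ℕ → List ℕ → Carrier
    aWeights j e []       = 1#
    aWeights j e (x ∷ αs) = aWeight j ^ (x +ℕ e) * aWeightsBelow j αs

    aWeightsBelow : ℕ → List ℕ → Carrier
    aWeightsBelow zero    αs = 1#
    aWeightsBelow (suc j) αs = aWeights j (aFloor j) αs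

  bWeights : ℕ → List ℕ → Carrier
  bWeights zero    β        = 1#
  bWeights (suc j) []       = 1#
  bWeights (suc j) (y ∷ βs) = bWeight j ^ suc y * bWeights j βs

  weight-partsFromA : ∀ j e α β → length α ≡ suc j → length β ≡ j → wt (partsFromA j e α β) ≈ aWeights j e α * bWeights j β
  weight-partsFromA zero    e (x ∷ []) [] _ _ =
    trans (weight-replicate-++ (weight-∷-aLevel 0) (x +ℕ e) []) (trans (*-congˡ weight-[]) (sym (*-identityʳ _)))
  weight-partsFromA (suc j) e (x ∷ αs) (y ∷ βs) α-length β-length = begin
    wt (replicate (x +ℕ e) (aLevel (suc j)) ++ (replicate (suc y) (bLevel j) ++ partsFromA j (aFloor j) αs βs))
      ≈⟨ weight-replicate-++ (weight-∷-aLevel (suc j)) (x +ℕ e) _ ⟩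
    A * wt (replicate (suc y) (bLevel j) ++ partsFromA j (aFloor j) αs βs)
      ≈⟨ *-congˡ (weight-replicate-++ (weight-∷-bLevel j) (suc y) _) ⟩
    A * (B * wt (partsFromA j (aFloor j) αs βs))
      ≈⟨ *-congˡ (*-congˡ (weight-partsFromA j (aFloor j) αs βs (ℕ.suc-injective α-length) (ℕ.suc-injective β-length))) ⟩
    A * (B * (aWeights j (aFloor j) αs * bWeights j βs))
      ≈⟨ solve 4 (λ u v w z → u :* (v :* (w :* z)) := u :* w :* (v :* z)) refl _ _ _ _ ⟩
    A * aWeights j (aFloor j) αs * (B * bWeights j βs) ∎
    where
    A = aWeight (suc j) ^ (x +ℕ e)
    B = bWeight j ^ suc y

  bWeight-^ : ∀ s n → bWeight s ^ n ≈ Y ^ n * Q ^ (s *ℕ n)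
  bWeight-^ s n = trans (^-distrib-* Y (Q ^ s) n) (*-congˡ (^-assocʳ Q s n))

  aWeight-^ : ∀ s n → aWeight s ^ n ≈ X ^ n * Q ^ (s *ℕ n)
  aWeight-^ s n = trans (^-distrib-* X (Q ^ s) n) (*-congˡ (^-assocʳ Q s n))

  ∑-bWeights : ∀ s h → ∑L (bWeights s) (bMultLists s h) ≈ Y ^ (h +ℕ s) * Q ^ triangle s * boundedCompGF Q r s h
  ∑-bWeights zero    zero    = trans (+-identityʳ _) (sym (trans (*-identityʳ _) (*-identityʳ _)))
  ∑-bWeights zero    (suc h) = sym (zeroʳ _)
  ∑-bWeights (suc s) h       = begin
    ∑L (bWeights (suc s)) (concatRange r (λ x → map (x ∷_) (atDiff [] (bMultLists s) h x)))
      ≈⟨ ∑L-concatRange (bWeights (suc s)) r _ ⟩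
    ∑[ x < r ] ∑L (bWeights (suc s)) (map (x ∷_) (atDiff [] (bMultLists s) h x))
      ≈⟨ ∑-cong r (λ x → trans (∑L-map (bWeights (suc s)) (x ∷_) (atDiff [] (bMultLists s) h x))
                               (trans (sym (∑L-distribˡ-* (bWeight s ^ suc x) (bWeights s) (atDiff [] (bMultLists s) h x)))
                                      (*-congˡ (∑L-atDiff (bWeights s) (bMultLists s) h x)))) ⟩
    ∑[ x < r ] (bWeight s ^ suc x * atDiff 0# (λ n → ∑L (bWeights s) (bMultLists s n)) h x)
      ≈⟨ ∑-cong r first-part ⟩
    ∑[ x < r ] (C * (Q ^ (s *ℕ x) * atDiff 0# (boundedCompGF Q r s) h x))
      ≈⟨ ∑-distribˡ-* r C _ ⟨
    C * boundedCompGF Q r (suc s) h ∎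
    where
    C = Y ^ (h +ℕ suc s) * Q ^ triangle (suc s)
    first-part : ∀ x → bWeight s ^ suc x * atDiff 0# (λ n → ∑L (bWeights s) (bMultLists s n)) h x
                       ≈ C * (Q ^ (s *ℕ x) * atDiff 0# (boundedCompGF Q r s) h x)
    first-part x with x ≤? h
    ... | no x≰h = begin
      bWeight s ^ suc x * atDiff 0# _ h x     ≈⟨ *-congˡ (reflexive (atDiff-> 0# _ (ℕ.≰⇒> x≰h))) ⟩
      bWeight s ^ suc x * 0#                  ≈⟨ zeroʳ _ ⟩
      0#
        ≈⟨ trans (*-congˡ (trans (*-congˡ (reflexive (atDiff-> 0# _ (ℕ.≰⇒> x≰h)))) (zeroʳ _))) (zeroʳ _) ⟨
      C * (Q ^ (s *ℕ x) * atDiff 0# (boundedCompGF Q r s) h x) ∎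
    ... | yes x≤h = begin
      bWeight s ^ suc x * atDiff 0# (λ n → ∑L (bWeights s) (bMultLists s n)) h x
        ≈⟨ *-cong (bWeight-^ s (suc x)) (trans (reflexive (atDiff-≤ 0# _ x≤h)) (∑-bWeights s (h ∸ x))) ⟩
      Y ^ suc x * Q ^ (s *ℕ suc x) * (Y ^ (h ∸ x +ℕ s) * Q ^ triangle s * B)
        ≈⟨ solve 5 (λ a b c d e → a :* b :* (c :* d :* e) := a :* c :* (b :* d) :* e) refl _ _ _ _ _ ⟩
      Y ^ suc x * Y ^ (h ∸ x +ℕ s) * (Q ^ (s *ℕ suc x) * Q ^ triangle s) * B
        ≈⟨ *-congʳ (*-cong (trans (sym (^-homo-* Y (suc x) _)) (^-congʳ Y Y-exponent))
                           (trans (sym (^-homo-* Q (s *ℕ suc x) _)) (trans (^-congʳ Q Q-exponent) (^-homo-* Q (triangle (suc s)) (s *ℕ x))))) ⟩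
      Y ^ (h +ℕ suc s) * (Q ^ triangle (suc s) * Q ^ (s *ℕ x)) * B
        ≈⟨ solve 4 (λ a b c d → a :* (b :* c) :* d := a :* b :* (c :* d)) refl _ _ _ _ ⟩
      C * (Q ^ (s *ℕ x) * B)
        ≈⟨ *-congˡ (*-congˡ (reflexive (atDiff-≤ 0# _ x≤h))) ⟨
      C * (Q ^ (s *ℕ x) * atDiff 0# (boundedCompGF Q r s) h x) ∎
      where
      B = boundedCompGF Q r s (h ∸ x)
      Y-exponent : suc x +ℕ (h ∸ x +ℕ s) ≡ h +ℕ suc s
      Y-exponent = ≡.trans (≡.cong suc (≡.trans (≡.sym (ℕ.+-assoc x (h ∸ x) s)) (≡.cong (_+ℕ s) (ℕ.m+[n∸m]≡n x≤h))))
                           (≡.sym (ℕ.+-suc h s))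
      Q-exponent : s *ℕ suc x +ℕ triangle s ≡ triangle (suc s) +ℕ s *ℕ x
      Q-exponent = ≡.trans (≡.cong (_+ℕ triangle s) (ℕ.*-suc s x))
                           (≡.trans (ℕ.+-comm (s +ℕ s *ℕ x) (triangle s)) (≡.sym (ℕ.+-assoc (triangle s) s (s *ℕ x))))

  aWeights-floor : ∀ j e x αs → aWeights j e (x ∷ αs) ≈ aWeight j ^ e * aWeights j 0 (x ∷ αs)
  aWeights-floor j e x αs = begin
    aWeight j ^ (x +ℕ e) * aWeightsBelow j αs
      ≈⟨ *-congʳ (trans (^-congʳ (aWeight j) (ℕ.+-comm x e)) (^-homo-* (aWeight j) e x)) ⟩
    aWeight j ^ e * aWeight j ^ x * aWeightsBelow j αs     ≈⟨ *-assoc _ _ _ ⟩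
    aWeight j ^ e * (aWeight j ^ x * aWeightsBelow j αs)   ≈⟨ *-congˡ (*-congʳ (^-congʳ (aWeight j) (≡.sym (ℕ.+-identityʳ x)))) ⟩
    aWeight j ^ e * (aWeight j ^ (x +ℕ 0) * aWeightsBelow j αs) ∎

  aWeight-floor : ∀ s y → aWeight s ^ aFloor s * (X ^ (y +ℕ (s ∸ 1)) * Q ^ triangle s) ≈ X ^ (y +ℕ s) * Q ^ triangle (suc s)
  aWeight-floor zero    y = *-identityˡ _
  aWeight-floor (suc s) y = begin
    X * Q ^ suc s * 1# * (X ^ (y +ℕ s) * Q ^ triangle (suc s))
      ≈⟨ solve 4 (λ x u v w → x :* u :* con 1 :* (v :* w) := x :* v :* (u :* w)) refl X (Q ^ suc s) (X ^ (y +ℕ s)) (Q ^ triangle (suc s)) ⟩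
    X ^ suc (y +ℕ s) * (Q ^ suc s * Q ^ triangle (suc s))
      ≈⟨ *-cong (^-congʳ X (≡.sym (ℕ.+-suc y s)))
                (trans (sym (^-homo-* Q (suc s) (triangle (suc s)))) (^-congʳ Q (ℕ.+-comm (suc s) (triangle (suc s))))) ⟩
    X ^ (y +ℕ suc s) * Q ^ (triangle (suc s) +ℕ suc s) ∎

  ∑-aWeights : ∀ s N → ∑L (aWeights s 0) (aMultLists s N) ≈ X ^ (N +ℕ (s ∸ 1)) * Q ^ triangle s * gauss Q (N +ℕ s) s
  ∑-aWeights zero    N = trans (+-identityʳ _) (trans (*-congʳ (^-congˡ (N +ℕ 0) (*-identityʳ X))) (sym (*-identityʳ _)))
  ∑-aWeights (suc s) N = begin
    ∑L (aWeights (suc s) 0) (concatRange (suc N) (λ y → map ((N ∸ y) ∷_) (aMultLists s y)))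
      ≈⟨ ∑L-concatRange (aWeights (suc s) 0) (suc N) _ ⟩
    ∑[ y < suc N ] ∑L (aWeights (suc s) 0) (map ((N ∸ y) ∷_) (aMultLists s y))
      ≈⟨ ∑-cong (suc N) (λ y → trans (∑L-map (aWeights (suc s) 0) ((N ∸ y) ∷_) (aMultLists s y))
                                     (sym (∑L-distribˡ-* (aWeight (suc s) ^ (N ∸ y +ℕ 0)) (aWeights s (aFloor s)) (aMultLists s y)))) ⟩
    ∑[ y < suc N ] (aWeight (suc s) ^ (N ∸ y +ℕ 0) * ∑L (aWeights s (aFloor s)) (aMultLists s y))
      ≈⟨ ∑-cong-< (suc N) top-part ⟩
    ∑[ y < suc N ] (C * (Q ^ (suc s *ℕ (N ∸ y)) * gauss Q (y +ℕ s) s))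
      ≈⟨ ∑-distribˡ-* (suc N) C _ ⟨
    C * ∑[ y < suc N ] (Q ^ (suc s *ℕ (N ∸ y)) * gauss Q (y +ℕ s) s)
      ≈⟨ *-congˡ (gauss-hockey-stick Q s N) ⟩
    C * gauss Q (N +ℕ suc s) (suc s) ∎
    where
    C = X ^ (N +ℕ s) * Q ^ triangle (suc s)
    floored : ∀ y → ∑L (aWeights s (aFloor s)) (aMultLists s y) ≈ aWeight s ^ aFloor s * ∑L (aWeights s 0) (aMultLists s y)
    floored y = trans (∑L-cong (aMultLists s y) floor-each) (sym (∑L-distribˡ-* _ (aWeights s 0) (aMultLists s y)))
      where
      floor-each : ∀ {α} → α ∈ aMultLists s y → aWeights s (aFloor s) α ≈ aWeight s ^ aFloor s * aWeights s 0 α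
      floor-each {α} α∈ with ∈-aMultLists⁻ s y α∈
      floor-each {x ∷ αs} _ | _ = aWeights-floor s (aFloor s) x αs
    top-part : ∀ y → y < suc N → aWeight (suc s) ^ (N ∸ y +ℕ 0) * ∑L (aWeights s (aFloor s)) (aMultLists s y)
                                 ≈ C * (Q ^ (suc s *ℕ (N ∸ y)) * gauss Q (y +ℕ s) s)
    top-part y (s≤s y≤N) = begin
      aWeight (suc s) ^ (N ∸ y +ℕ 0) * ∑L (aWeights s (aFloor s)) (aMultLists s y)
        ≈⟨ *-cong (trans (^-congʳ (aWeight (suc s)) (ℕ.+-identityʳ (N ∸ y))) (aWeight-^ (suc s) (N ∸ y)))
                  (trans (floored y) (*-congˡ (∑-aWeights s y))) ⟩
      X ^ (N ∸ y) * Q ^ (suc s *ℕ (N ∸ y)) * (aWeight s ^ aFloor s * (X ^ (y +ℕ (s ∸ 1)) * Q ^ triangle s * gauss Q (y +ℕ s) s))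
        ≈⟨ solve 6 (λ a b c d e g → a :* b :* (c :* (d :* e :* g)) := a :* (c :* (d :* e)) :* (b :* g)) refl _ _ _ _ _ _ ⟩
      X ^ (N ∸ y) * (aWeight s ^ aFloor s * (X ^ (y +ℕ (s ∸ 1)) * Q ^ triangle s)) * (Q ^ (suc s *ℕ (N ∸ y)) * gauss Q (y +ℕ s) s)
        ≈⟨ *-congʳ (*-congˡ (aWeight-floor s y)) ⟩
      X ^ (N ∸ y) * (X ^ (y +ℕ s) * Q ^ triangle (suc s)) * (Q ^ (suc s *ℕ (N ∸ y)) * gauss Q (y +ℕ s) s)
        ≈⟨ *-congʳ (trans (sym (*-assoc _ _ _)) (*-congʳ (trans (sym (^-homo-* X (N ∸ y) _)) (^-congʳ X X-exponent)))) ⟩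
      C * (Q ^ (suc s *ℕ (N ∸ y)) * gauss Q (y +ℕ s) s) ∎
      where
      X-exponent : N ∸ y +ℕ (y +ℕ s) ≡ N +ℕ s
      X-exponent = ≡.trans (≡.sym (ℕ.+-assoc (N ∸ y) y s)) (≡.cong (_+ℕ s) (ℕ.m∸n+n≡m y≤N))

  ∑-profilesWith : ∀ m s h → ∑L (λ t → wt (parts t)) (profilesWith m s h) ≈
    atDiff 0# (λ N → X ^ (N +ℕ (s ∸ 1)) * Q ^ triangle s * gauss Q (N +ℕ s) s * (Y ^ (h +ℕ s) * Q ^ triangle s * boundedCompGF Q r s h))
              (suc m) (h +ℕ s +ℕ s)
  ∑-profilesWith m s h =
    trans (∑L-atDiff (λ t → wt (parts t)) (λ N → map (toProfile s) (cartesianProduct (aMultLists s N) (bMultLists s h)))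
                     (suc m) (h +ℕ s +ℕ s))
          (atDiff-cong fixed-sum (suc m) (h +ℕ s +ℕ s))
    where
    fixed-sum : ∀ N → ∑L (λ t → wt (parts t)) (map (toProfile s) (cartesianProduct (aMultLists s N) (bMultLists s h))) ≈
                      X ^ (N +ℕ (s ∸ 1)) * Q ^ triangle s * gauss Q (N +ℕ s) s * (Y ^ (h +ℕ s) * Q ^ triangle s * boundedCompGF Q r s h)
    fixed-sum N = begin
      ∑L (λ t → wt (parts t)) (map (toProfile s) αβs)
        ≈⟨ ∑L-map (λ t → wt (parts t)) (toProfile s) αβs ⟩
      ∑L (λ p → wt (partsFromA s 0 (proj₁ p) (proj₂ p))) αβs
        ≈⟨ ∑L-cong αβs factorise ⟩
      ∑L (λ p → aWeights s 0 (proj₁ p) * bWeights s (proj₂ p)) αβs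
        ≈⟨ ∑L-cartesianProduct (aWeights s 0) (bWeights s) (aMultLists s N) (bMultLists s h) ⟩
      ∑L (aWeights s 0) (aMultLists s N) * ∑L (bWeights s) (bMultLists s h)
        ≈⟨ *-cong (∑-aWeights s N) (∑-bWeights s h) ⟩
      X ^ (N +ℕ (s ∸ 1)) * Q ^ triangle s * gauss Q (N +ℕ s) s * (Y ^ (h +ℕ s) * Q ^ triangle s * boundedCompGF Q r s h) ∎
      where
      αβs = cartesianProduct (aMultLists s N) (bMultLists s h)
      factorise : ∀ {p} → p ∈ αβs → wt (partsFromA s 0 (proj₁ p) (proj₂ p)) ≈ aWeights s 0 (proj₁ p) * bWeights s (proj₂ p)
      factorise {α , β} p∈ with ∈-cartesianProduct⁻ (aMultLists s N) (bMultLists s h) p∈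
      ... | α∈ , β∈ = weight-partsFromA s 0 α β (proj₁ (∈-aMultLists⁻ s N α∈)) (proj₁ (∈-bMultLists⁻ s h β∈))

  summand : ℕ → ℕ → ℕ → Carrier
  summand m s′ h = μ ^ (m ∸ h ∸ suc s′) * ν ^ (h +ℕ suc s′)
                 * q ^ ((m ∸ h ∸ suc s′) *ℕ a +ℕ (h +ℕ suc s′) *ℕ b +ℕ k *ℕ (suc s′ *ℕ suc s′ ∸ suc s′))
                 * g R q k r h (suc s′)
                 * qbin R q k (+ m ℤ.- + h ℤ.- + suc s′ ℤ.+ + 1) (+ suc s′)

  split-powers : ∀ A B n → μ ^ A * ν ^ B * q ^ (A *ℕ a +ℕ B *ℕ b +ℕ k *ℕ n) ≈ X ^ A * Y ^ B * Q ^ n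
  split-powers A B n = begin
    μ ^ A * ν ^ B * q ^ (A *ℕ a +ℕ B *ℕ b +ℕ k *ℕ n)
      ≈⟨ *-congˡ (trans (^-homo-* q (A *ℕ a +ℕ B *ℕ b) (k *ℕ n)) (*-congʳ (^-homo-* q (A *ℕ a) (B *ℕ b)))) ⟩
    μ ^ A * ν ^ B * (q ^ (A *ℕ a) * q ^ (B *ℕ b) * q ^ (k *ℕ n))
      ≈⟨ solve 5 (λ u v x y w → u :* v :* (x :* y :* w) := u :* x :* (v :* y) :* w) refl _ _ _ _ _ ⟩
    μ ^ A * q ^ (A *ℕ a) * (ν ^ B * q ^ (B *ℕ b)) * q ^ (k *ℕ n)
      ≈⟨ *-cong (*-cong (*-congˡ (^-power a A)) (*-congˡ (^-power b B))) (sym (^-assocʳ q k n)) ⟩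
    μ ^ A * (q ^ a) ^ A * (ν ^ B * (q ^ b) ^ B) * Q ^ n
      ≈⟨ *-congʳ (*-cong (sym (^-distrib-* μ (q ^ a) A)) (sym (^-distrib-* ν (q ^ b) B))) ⟩
    X ^ A * Y ^ B * Q ^ n ∎
    where
    ^-power : ∀ e n → q ^ (n *ℕ e) ≈ (q ^ e) ^ n
    ^-power e n = sym (trans (^-assocʳ q e n) (^-congʳ q (ℕ.*-comm e n)))

  ∑-profilesWith≈summand : ∀ m s′ h → ∑L (λ t → wt (parts t)) (profilesWith m (suc s′) h) ≈ summand m s′ h
  ∑-profilesWith≈summand m s′ h with h +ℕ suc s′ +ℕ suc s′ ≤? suc m
  ... | no D≰1+m = begin
    ∑L (λ t → wt (parts t)) (profilesWith m s h) ≈⟨ trans (∑-profilesWith m s h) (reflexive (atDiff-> 0# _ (ℕ.≰⇒> D≰1+m))) ⟩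
    0#
      ≈⟨ trans (*-congˡ (trans (qbin-rhs q k m h s) (reflexive (atDiff-> 0# _ (ℕ.≰⇒> D≰1+m))))) (zeroʳ _) ⟨
    summand m s′ h                               ∎
    where s = suc s′
  ... | yes D≤1+m = begin
    ∑L (λ t → wt (parts t)) (profilesWith m s h)
      ≈⟨ trans (∑-profilesWith m s h) (reflexive (atDiff-≤ 0# _ D≤1+m)) ⟩
    X ^ (N +ℕ s′) * Q ^ triangle s * gauss Q (N +ℕ s) s * (Y ^ (h +ℕ s) * Q ^ triangle s * boundedCompGF Q r s h)
      ≈⟨ solve 6 (λ x t G y B t′ → x :* t :* G :* (y :* t′ :* B) := x :* y :* (t :* t′) :* B :* G) refl
                 (X ^ (N +ℕ s′)) (Q ^ triangle s) (gauss Q (N +ℕ s) s) (Y ^ (h +ℕ s)) (boundedCompGF Q r s h) (Q ^ triangle s) ⟩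
    X ^ (N +ℕ s′) * Y ^ (h +ℕ s) * (Q ^ triangle s * Q ^ triangle s) * boundedCompGF Q r s h * gauss Q (N +ℕ s) s
      ≈⟨ *-cong (*-cong (*-cong (*-congʳ (^-congʳ X (≡.sym (a-part-count m s′ h D≤1+m)))) Q-exponent)
                        (sym (g≈boundedCompGF q k r h s′)))
                (sym qbin≈gauss) ⟩
    X ^ A * Y ^ (h +ℕ s) * Q ^ (s *ℕ s ∸ s) * g R q k r h s * qbin R q k (+ m ℤ.- + h ℤ.- + s ℤ.+ + 1) (+ s)
      ≈⟨ *-congʳ (*-congʳ (sym (split-powers A (h +ℕ s) (s *ℕ s ∸ s)))) ⟩
    summand m s′ h ∎
    where
    s = suc s′
    D = h +ℕ s +ℕ s
    N = suc m ∸ D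
    A = m ∸ h ∸ s
    Q-exponent : Q ^ triangle s * Q ^ triangle s ≈ Q ^ (s *ℕ s ∸ s)
    Q-exponent = trans (sym (^-homo-* Q (triangle s) (triangle s))) (^-congʳ Q (≡.sym (i*i∸i≡triangle+triangle s)))
    qbin≈gauss : qbin R q k (+ m ℤ.- + h ℤ.- + s ℤ.+ + 1) (+ s) ≈ gauss Q (N +ℕ s) s
    qbin≈gauss = trans (qbin-rhs q k m h s) (reflexive (atDiff-≤ 0# _ D≤1+m))

  ∑-profiles : ∀ m → ∑L (λ t → wt (parts t)) (profiles m) ≈ rhs R μ ν q a b k r m
  ∑-profiles m = +-cong flat-weight (trans (∑L-concatRange _ m _) (∑-cong m λ s′ →
                   trans (∑L-concatRange _ (suc m) _) (∑-cong (suc m) (∑-profilesWith≈summand m s′))))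
    where
    flat-weight : wt (replicate (m +ℕ 0) a ++ []) ≈ μ ^ m * q ^ (m *ℕ a)
    flat-weight = begin
      wt (replicate (m +ℕ 0) a ++ [])    ≈⟨ weight-replicate-++ (weight-∷-aLevel 0) (m +ℕ 0) [] ⟩
      aWeight 0 ^ (m +ℕ 0) * wt []
        ≈⟨ *-cong (trans (^-congʳ (aWeight 0) (ℕ.+-identityʳ m)) (^-congˡ m (*-identityʳ X))) weight-[] ⟩
      X ^ m * 1#                         ≈⟨ *-identityʳ _ ⟩
      X ^ m                              ≈⟨ ^-distrib-* μ (q ^ a) m ⟩
      μ ^ m * (q ^ a) ^ m                ≈⟨ *-congˡ (trans (^-assocʳ q a m) (^-congʳ q (ℕ.*-comm a m))) ⟩
      μ ^ m * q ^ (m *ℕ a)               ∎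

theorem3p3 : ∀ {c ℓ′ : Level} (R : CommutativeRing c ℓ′) (μ ν q : CommutativeRing.Carrier R)
    (k a b r : ℕ) .{{_ : NonZero k}} → 1 ≤ a → a < b → b ≤ k → 1 ≤ r →
    (m : ℕ) → 1 ≤ m →
    (E : List (List ℕ)) → Unique E → (∀ π → (π ∈ E) ⇔ BP a b k r m π) →
    CommutativeRing._≈_ R (sumList R (Data.List.map (weight R μ ν q a b k) E)) (rhs R μ ν q a b k r m)
theorem3p3 R μ ν q k a b r 1≤a a<b b≤k 1≤r zero    () E E-unique E⇔BP
theorem3p3 R μ ν q k a b r 1≤a a<b b≤k 1≤r (suc m) _  E E-unique E⇔BP = begin
  ∑L (weight R μ ν q a b k) E                   ≈⟨ ∑L-↭ (weight R μ ν q a b k) E↭partitions ⟩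
  ∑L (weight R μ ν q a b k) (partitions (suc m)) ≈⟨ ∑L-map (weight R μ ν q a b k) parts (profiles (suc m)) ⟩
  ∑L (λ t → wt (parts t)) (profiles (suc m))     ≈⟨ ∑-profiles (suc m) ⟩
  rhs R μ ν q a b k r (suc m)                    ∎
  where
  open CommutativeRing R using (setoid)
  open ≈-Reasoning setoid
  open RingSums R using (∑L; ∑L-↭; ∑L-map)
  open Profiles a b k r 1≤a a<b b≤k 1≤r using (parts; profiles; partitions; partitions-unique; ∈-partitions⇔BP)
  open Weights R μ ν q a b k r 1≤a a<b b≤k 1≤r using (wt; ∑-profiles)
  E↭partitions : E ↭ partitions (suc m)
  E↭partitions = ∼bag⇒↭ (unique∧set⇒bag E-unique (partitions-unique (suc m))
                                         (λ {π} → ⇔-sym (∈-partitions⇔BP m) ⇔-∘ E⇔BP π))
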